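{- For every integer $n\ge 0$, the following identity of polynomials in $x$ holds: \[ B_{n}(x)=\sum_{k=0}^{n}\left( \left(2^{k+2}k+2^{k+1}\right)\sum_{\substack{0\le j\le n\\ j-k\equiv 0 \pmod 2}}\frac{j!\binom{n}{j}\left(\frac{j+k+2}{2}\right)!}{\left(\frac{j-k}{2}\right)!\,(j+k+2)!}\,B_{n-j}\right)P_{k}(x). \]
   Context: $P_k(x)$ denotes the $k$-th Legendre polynomial, defined by $\frac{1}{\sqrt{1-2xt+t^2}}=\sum_{k\ge 0}P_k(x)t^k$ (equivalently $P_k(x)=\frac{1}{k!2^k}\frac{d^k}{dx^k}(x^2-1)^k$). The Bernoulli polynomials $B_n(x)$ are defined by $\frac{t}{e^t-1}e^{xt}=\sum_{n\ge0}B_n(x)\frac{t^n}{n!}$, and $B_m:=B_m(0)$ denotes the $m$-th Bernoulli number. Convention: terms in the inner sum with $j<k$ (where $\frac{j-k}{2}$ is a negative integer) are taken to be $0$, i.e. $1/m!=0$ for negative integers $m$. -}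

module Defs where

open import Data.Nat as ℕ using (ℕ; zero; suc; _!; _∸_; _≤?_; NonZero)
open import Data.Nat.Properties using (_!≢0; _!*_!≢0)
open import Data.Nat.DivMod using (_/_; _%_)
open import Data.Nat.Combinatorics using (_C_)
open import Data.Integer using (+_)
open import Data.Rational as ℚ using (ℚ; 0ℚ; 1ℚ; _+_; _*_; -_)
open import Data.List using (List; []; _∷_; _++_; [_])
open import Relation.Nullary using (yes; no)

ι : ℕ → ℚ
ι n = (+ n) ℚ./ 1

sumTo : ℕ → (ℕ → ℚ) → ℚ
sumTo zero    f = f 0
sumTo (suc n) f = sumTo n f + f (suc n)

pow : ℚ → ℕ → ℚ
pow x zero    = 1ℚ
pow x (suc n) = x * pow x n

-- index into a list (0 if out of range)
nth : List ℚ → ℕ → ℚ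
nth []       _       = 0ℚ
nth (a ∷ as) zero    = a
nth (a ∷ as) (suc i) = nth as i

-- Comparing coefficients of t^{m+1} in t = (e^t - 1) * Σ B_n t^n/n!
-- gives B_0 = 1 and  Σ_{k=0}^{m} C(m+1,k) B_k = 0  for m ≥ 1, i.e.
--   B_m = -(1/(m+1)) Σ_{k<m} C(m+1,k) B_k   (so B_1 = -1/2).
-- bernList m = [B_0, …, B_m].

bernList : ℕ → List ℚ
bernList zero    = [ 1ℚ ]
bernList (suc m) =
  bernList m ++
  [ - (((+ 1) ℚ./ (suc (suc m))) *
       sumTo m (λ k → ι (suc (suc m) C k) * nth (bernList m) k)) ]

bernoulliNumber : ℕ → ℚ
bernoulliNumber m = nth (bernList m) m

-- Multiplying t/(e^t-1) by e^{xt}:  B_n(x) = Σ_{k=0}^{n} C(n,k) B_k x^{n-k}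
bernoulliPoly : ℕ → ℚ → ℚ
bernoulliPoly n x = sumTo n (λ k → ι (n C k) * bernoulliNumber k * pow x (n ∸ k))

-- Polynomials over ℚ as coefficient lists (constant term first).

Poly : Set
Poly = List ℚ

padd : Poly → Poly → Poly
padd []       q        = q
padd p        []       = p
padd (a ∷ p)  (b ∷ q)  = (a + b) ∷ padd p q

pscale : ℚ → Poly → Poly
pscale c []      = []
pscale c (a ∷ p) = (c * a) ∷ pscale c p

pmul : Poly → Poly → Poly
pmul []      q = []
pmul (a ∷ p) q = padd (pscale a q) (0ℚ ∷ pmul p q)

ppow : Poly → ℕ → Poly
ppow p zero    = [ 1ℚ ]
ppow p (suc n) = pmul p (ppow p n)

derivAux : ℕ → Poly → Poly
derivAux n []      = []
derivAux n (b ∷ p) = (ι n * b) ∷ derivAux (suc n) p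

pderiv : Poly → Poly
pderiv []      = []
pderiv (a ∷ p) = derivAux 1 p

pderivN : ℕ → Poly → Poly
pderivN zero    p = p
pderivN (suc k) p = pderivN k (pderiv p)

peval : Poly → ℚ → ℚ
peval []      x = 0ℚ
peval (a ∷ p) x = a + x * peval p x

-- Legendre polynomials via Rodrigues' formula:
--   P_k(x) = 1/(k! 2^k) d^k/dx^k (x^2 - 1)^k

legendre : ℕ → ℚ → ℚ
legendre k x =
  ((+ 1) ℚ./ (k ! ℕ.* 2 ℕ.^ k)) {{nz}} *
    peval (pderivN k (ppow (- 1ℚ ∷ 0ℚ ∷ 1ℚ ∷ []) k)) x
  where
  nz : NonZero (k ! ℕ.* 2 ℕ.^ k)
  nz = Data.Nat.Properties.m*n≢0 (k !) (2 ℕ.^ k) {{k !≢0}} {{Data.Nat.Properties.m^n≢0 2 k}}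
    where import Data.Nat.Properties

-- The inner summand of the theorem:
--   j! C(n,j) ((j+k+2)/2)! / ( ((j-k)/2)! (j+k+2)! ) · B_{n-j}
-- when j ≥ k and j - k ≡ 0 (mod 2); 0 otherwise
-- (the condition j ≥ k is the convention 1/m! = 0 for negative m).

innerTerm : ℕ → ℕ → ℕ → ℚ
innerTerm n k j with k ≤? j | (j ∸ k) % 2
... | yes _ | zero =
  ((+ (j ! ℕ.* (n C j) ℕ.* ((j ℕ.+ k ℕ.+ 2) / 2) !))
     ℚ./ (((j ∸ k) / 2) ! ℕ.* (j ℕ.+ k ℕ.+ 2) !)) {{((j ∸ k) / 2) !* (j ℕ.+ k ℕ.+ 2) !≢0}}
  * bernoulliNumber (n ∸ j)
... | yes _ | suc _ = 0ℚ
... | no  _ | _     = 0ℚ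

legendreCoeff : ℕ → ℕ → ℚ
legendreCoeff n k =
  ι (2 ℕ.^ (k ℕ.+ 2) ℕ.* k ℕ.+ 2 ℕ.^ (k ℕ.+ 1)) * sumTo n (innerTerm n k)

module Submission where

-- Write b_j = C(n,j) B_{n-j}, so that B_n(x) = Σ_j b_j x^j.  The coefficient of
-- P_k in the theorem is Σ_j b_j c(j,k) with c(j,k) = weight k · monoFactor j k, and
-- c(j,k) is exactly the coefficient of P_k in the classical expansion of the monomial
-- x^j in Legendre polynomials.  Hence the theorem is a linear combination of the
-- monomial expansions  x^j = Σ_k c(j,k) P_k(x)  (monomial-expansion).
--
-- To prove the monomial expansion we expand P_k in monomials via Rodrigues' formula
-- (legendre-sum: the coefficient of x^i is legendreMono k i) and show that the two
-- coefficient matrices are mutually inverse:  Σ_k c(j,k) legendreMono k i = δ i j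
-- (orthogonality).  All terms vanish unless k = i + 2s and j = k + 2t; the
-- surviving sum over s + t = r is a hypergeometric sum, evaluated by exhibiting
-- its partial sums in closed form (partial-sum) and checking the telescoping
-- steps as identities between products of factorials.

open import Defs
open import Data.Nat as ℕ using (ℕ; zero; suc; _≤_; _<_; z≤n; s≤s; _∸_; _!; _≤?_; NonZero)
import Data.Nat.Properties as ℕP
open import Data.Nat.DivMod using (_/_; _%_; m≡m%n+[m/n]*n; m*n/n≡m; m*n%n≡0; m/n*n≡m)
open import Data.Nat.Combinatorics using (_C_; k>n⇒nCk≡0; nCk+nC[k+1]≡[n+1]C[k+1]; nCk≡n!/k![n-k]!; k![n∸k]!∣n!; nCk≡nC[n∸k])
import Data.Integer as ℤ
import Data.Integer.Properties as ℤP
open import Data.Rational as ℚ using (ℚ; 0ℚ; 1ℚ; _+_; _*_; -_)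
open import Data.Rational.Properties hiding (_≤?_)
open import Data.Rational.Unnormalised as U using (ℚᵘ; mkℚᵘ; *≡*)
import Data.Rational.Unnormalised.Properties as UP
open import Relation.Binary.PropositionalEquality
open import Data.Empty using (⊥; ⊥-elim)
open import Data.List using ([]; _∷_)
open import Data.Maybe using (Maybe; just; nothing; maybe)
import Data.Maybe as Maybe
open import Data.Product using (Σ; _,_; _×_)
open import Data.Sum using (_⊎_; inj₁; inj₂)
open import Relation.Nullary using (yes; no; ¬_)
open import Relation.Binary.Definitions using (Tri; tri<; tri≈; tri>)
open import Function using (_∘_; _∋_)
open import Data.Rational.Solver
open +-*-Solver
import Data.Nat.Solver as NatSolver
-- Index arithmetic is discharged by the reflective solver solve-∀; the large identities
-- between products of factorials by the explicit solver N.solve, which handles them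
-- far more cheaply.
module N = NatSolver.+-*-Solver
open import Data.Nat.Tactic.RingSolver using (solve-∀)

-- The rational a/b with natural numerator and nonzero denominator, written exactly as
-- Defs writes its fractions, so that its occurrences there unfold to it.
divℚ : (a b : ℕ) → .{{NonZero b}} → ℚ
divℚ a b = (ℤ.+ a) ℚ./ b

-- divℚ a (suc b) is the normalisation of this unnormalised fraction; equalities of
-- fractions are proved by computing with unnormalised representatives.
unnormalised : ℕ → ℕ → ℚᵘ
unnormalised a b = mkℚᵘ (ℤ.+ a) b

divℚ-cross : ∀ a b c d .{{_ : NonZero b}} .{{_ : NonZero d}} →
  a ℕ.* d ≡ c ℕ.* b → divℚ a b ≡ divℚ c d
divℚ-cross a (suc b) c (suc d) eq =
  fromℚᵘ-cong {unnormalised a b} {unnormalised c d} (*≡* (begin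
    ℤ.+ a ℤ.* ℤ.+ suc d  ≡⟨ ℤP.pos-* a (suc d) ⟨
    ℤ.+ (a ℕ.* suc d)  ≡⟨ cong ℤ.+_ eq ⟩
    ℤ.+ (c ℕ.* suc b)  ≡⟨ ℤP.pos-* c (suc b) ⟩
    ℤ.+ c ℤ.* ℤ.+ suc b  ∎))
  where open ≡-Reasoning

divℚ-mul : ∀ a b c d .{{_ : NonZero b}} .{{_ : NonZero d}} →
  divℚ a b * divℚ c d ≡ (divℚ (a ℕ.* c) (b ℕ.* d)) {{ℕP.m*n≢0 b d}}
divℚ-mul a (suc b) c (suc d) = begin
  divℚ a (suc b) * divℚ c (suc d)
    ≡⟨ fromℚᵘ-toℚᵘ _ ⟨
  ℚ.fromℚᵘ (ℚ.toℚᵘ (divℚ a (suc b) * divℚ c (suc d)))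
    ≡⟨ fromℚᵘ-cong (toℚᵘ-homo-* (divℚ a (suc b)) (divℚ c (suc d))) ⟩
  ℚ.fromℚᵘ (ℚ.toℚᵘ (divℚ a (suc b)) U.* ℚ.toℚᵘ (divℚ c (suc d)))
    ≡⟨ fromℚᵘ-cong (UP.*-cong (toℚᵘ-fromℚᵘ (unnormalised a b)) (toℚᵘ-fromℚᵘ (unnormalised c d))) ⟩
  ℚ.fromℚᵘ (unnormalised a b U.* unnormalised c d)
    ≡⟨ fromℚᵘ-cong {unnormalised a b U.* unnormalised c d}
                   {unnormalised (a ℕ.* c) (ℕ.pred (suc b ℕ.* suc d))}
                   (*≡* (cong (ℤ._* (ℤ.+ (suc b ℕ.* suc d))) (sym (ℤP.pos-* a c)))) ⟩
  divℚ (a ℕ.* c) (suc b ℕ.* suc d) ∎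
  where open ≡-Reasoning

divℚ-add : ∀ a b c d .{{_ : NonZero b}} .{{_ : NonZero d}} →
  divℚ a b + divℚ c d ≡ (divℚ (a ℕ.* d ℕ.+ c ℕ.* b) (b ℕ.* d)) {{ℕP.m*n≢0 b d}}
divℚ-add a (suc b) c (suc d) = begin
  divℚ a (suc b) + divℚ c (suc d)
    ≡⟨ fromℚᵘ-toℚᵘ _ ⟨
  ℚ.fromℚᵘ (ℚ.toℚᵘ (divℚ a (suc b) + divℚ c (suc d)))
    ≡⟨ fromℚᵘ-cong (toℚᵘ-homo-+ (divℚ a (suc b)) (divℚ c (suc d))) ⟩
  ℚ.fromℚᵘ (ℚ.toℚᵘ (divℚ a (suc b)) U.+ ℚ.toℚᵘ (divℚ c (suc d)))
    ≡⟨ fromℚᵘ-cong (UP.+-cong (toℚᵘ-fromℚᵘ (unnormalised a b)) (toℚᵘ-fromℚᵘ (unnormalised c d))) ⟩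
  ℚ.fromℚᵘ (unnormalised a b U.+ unnormalised c d)
    ≡⟨ fromℚᵘ-cong {unnormalised a b U.+ unnormalised c d}
                   {unnormalised (a ℕ.* suc d ℕ.+ c ℕ.* suc b) (ℕ.pred (suc b ℕ.* suc d))}
                   (*≡* (cong (ℤ._* (ℤ.+ (suc b ℕ.* suc d))) numerator)) ⟩
  divℚ (a ℕ.* suc d ℕ.+ c ℕ.* suc b) (suc b ℕ.* suc d) ∎
  where
  open ≡-Reasoning
  numerator : ℤ.+ a ℤ.* ℤ.+ suc d ℤ.+ ℤ.+ c ℤ.* ℤ.+ suc b ≡ ℤ.+ (a ℕ.* suc d ℕ.+ c ℕ.* suc b)
  numerator = trans (cong₂ ℤ._+_ (sym (ℤP.pos-* a (suc d))) (sym (ℤP.pos-* c (suc b))))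
                    (sym (ℤP.pos-+ (a ℕ.* suc d) (c ℕ.* suc b)))

-- The total version of divℚ (value 0 for denominator 0), convenient for bookkeeping
-- with products of factorials; its laws need nonzero denominators only where they must.
frac : ℕ → ℕ → ℚ
frac a zero    = 0ℚ
frac a (suc b) = divℚ a (suc b)

divℚ≡frac : ∀ a b .{{_ : NonZero b}} → divℚ a b ≡ frac a b
divℚ≡frac a (suc b) = refl

frac-cross : ∀ a b c d → b ≢ 0 → d ≢ 0 → a ℕ.* d ≡ c ℕ.* b → frac a b ≡ frac c d
frac-cross a zero    c d       b≢0 _   _  = ⊥-elim (b≢0 refl)
frac-cross a (suc b) c zero    _   d≢0 _  = ⊥-elim (d≢0 refl)
frac-cross a (suc b) c (suc d) _   _   eq = divℚ-cross a (suc b) c (suc d) eq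

frac-mul : ∀ a b c d → frac a b * frac c d ≡ frac (a ℕ.* c) (b ℕ.* d)
frac-mul a zero    c d       = *-zeroˡ (frac c d)
frac-mul a (suc b) c zero    = trans (*-zeroʳ (divℚ a (suc b))) (cong (frac (a ℕ.* c)) (sym (ℕP.*-zeroʳ b)))
frac-mul a (suc b) c (suc d) = divℚ-mul a (suc b) c (suc d)

frac-add : ∀ a b c d → b ≢ 0 → d ≢ 0 → frac a b + frac c d ≡ frac (a ℕ.* d ℕ.+ c ℕ.* b) (b ℕ.* d)
frac-add a zero    c d       b≢0 _   = ⊥-elim (b≢0 refl)
frac-add a (suc b) c zero    _   d≢0 = ⊥-elim (d≢0 refl)
frac-add a (suc b) c (suc d) _   _   = divℚ-add a (suc b) c (suc d)

frac-cong : ∀ {a b c d} → a ≡ c → b ≡ d → frac a b ≡ frac c d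
frac-cong refl refl = refl

ι-* : ∀ a b → ι (a ℕ.* b) ≡ ι a * ι b
ι-* a b = sym (divℚ-mul a 1 b 1)

ι-+ : ∀ a b → ι (a ℕ.+ b) ≡ ι a + ι b
ι-+ a b = sym (trans (divℚ-add a 1 b 1) (cong₂ (λ u v → divℚ (u ℕ.+ v) 1) (ℕP.*-identityʳ a) (ℕP.*-identityʳ b)))

fact≢0 : ∀ n → n ! ≢ 0
fact≢0 n = ℕ.≢-nonZero⁻¹ (n !) {{n ℕP.!≢0}}

pow2≢0 : ∀ n → 2 ℕ.^ n ≢ 0
pow2≢0 n = ℕ.≢-nonZero⁻¹ (2 ℕ.^ n) {{ℕP.m^n≢0 2 n}}

suc≢0 : ∀ n → suc n ≢ 0
suc≢0 n ()

infixl 7 _*≢0_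

_*≢0_ : ∀ {m n} → m ≢ 0 → n ≢ 0 → m ℕ.* n ≢ 0
_*≢0_ {m} {n} a b eq with ℕP.m*n≡0⇒m≡0∨n≡0 m eq
... | inj₁ x = a x
... | inj₂ y = b y

sumTo-cong : ∀ n {f g : ℕ → ℚ} → (∀ k → k ≤ n → f k ≡ g k) → sumTo n f ≡ sumTo n g
sumTo-cong zero h = h 0 z≤n
sumTo-cong (suc n) h = cong₂ _+_ (sumTo-cong n (λ k k≤n → h k (ℕP.m≤n⇒m≤1+n k≤n))) (h (suc n) ℕP.≤-refl)

sumTo-shift : ∀ n (f : ℕ → ℚ) → sumTo (suc n) f ≡ f 0 + sumTo n (f ∘ suc)
sumTo-shift zero f = refl
sumTo-shift (suc n) f = trans (cong (_+ f (suc (suc n))) (sumTo-shift n f)) (+-assoc (f 0) _ _)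

sumTo-+ : ∀ n (f g : ℕ → ℚ) → sumTo n (λ k → f k + g k) ≡ sumTo n f + sumTo n g
sumTo-+ zero f g = refl
sumTo-+ (suc n) f g = trans (cong (_+ (f (suc n) + g (suc n))) (sumTo-+ n f g))
  (solve 4 (λ a b c d → (a :+ b) :+ (c :+ d) := (a :+ c) :+ (b :+ d)) refl (sumTo n f) (sumTo n g) (f (suc n))
      (g (suc n)))

sumTo-*l : ∀ n c (f : ℕ → ℚ) → c * sumTo n f ≡ sumTo n (λ k → c * f k)
sumTo-*l zero c f = refl
sumTo-*l (suc n) c f = trans (*-distribˡ-+ c (sumTo n f) (f (suc n))) (cong (_+ (c * f (suc n))) (sumTo-*l n c f))

sumTo-*r : ∀ n c (f : ℕ → ℚ) → sumTo n f * c ≡ sumTo n (λ k → f k * c)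
sumTo-*r n c f = trans (*-comm (sumTo n f) c) (trans (sumTo-*l n c f) (sumTo-cong n (λ k _ → *-comm c (f k))))

sumTo-swap : ∀ n m (f : ℕ → ℕ → ℚ) →
  sumTo n (λ a → sumTo m (λ b → f a b)) ≡ sumTo m (λ b → sumTo n (λ a → f a b))
sumTo-swap zero m f = refl
sumTo-swap (suc n) m f = trans (cong (_+ sumTo m (f (suc n))) (sumTo-swap n m f))
  (sym (sumTo-+ m (λ b → sumTo n (λ a → f a b)) (f (suc n))))

sumTo-zero : ∀ n (f : ℕ → ℚ) → (∀ k → k ≤ n → f k ≡ 0ℚ) → sumTo n f ≡ 0ℚ
sumTo-zero zero f h = h 0 z≤n
sumTo-zero (suc n) f h = trans
    (cong₂ _+_ (sumTo-zero n f (λ k k≤n → h k (ℕP.m≤n⇒m≤1+n k≤n))) (h (suc n) ℕP.≤-refl)) (+-identityˡ 0ℚ)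

sumTo-tail : ∀ m d (f : ℕ → ℚ) → (∀ k → m < k → f k ≡ 0ℚ) → sumTo (m ℕ.+ d) f ≡ sumTo m f
sumTo-tail m zero f h = cong (λ t → sumTo t f) (ℕP.+-identityʳ m)
sumTo-tail m (suc d) f h = begin
  sumTo (m ℕ.+ suc d) f ≡⟨ cong (λ t → sumTo t f) (ℕP.+-suc m d) ⟩
  sumTo (m ℕ.+ d) f + f (suc (m ℕ.+ d)) ≡⟨ cong₂ _+_ (sumTo-tail m d f h) (h _ (s≤s (ℕP.m≤m+n m d))) ⟩
  sumTo m f + 0ℚ ≡⟨ +-identityʳ _ ⟩
  sumTo m f ∎
  where open ≡-Reasoning

sumTo-offset : ∀ i N (f : ℕ → ℚ) → (∀ k → k < i → f k ≡ 0ℚ) → sumTo (i ℕ.+ N) f ≡ sumTo N (λ k → f (i ℕ.+ k))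
sumTo-offset zero N f h = refl
sumTo-offset (suc i) N f h = begin
  sumTo (suc (i ℕ.+ N)) f ≡⟨ sumTo-shift (i ℕ.+ N) f ⟩
  f 0 + sumTo (i ℕ.+ N) (f ∘ suc)
    ≡⟨ cong₂ _+_ (h 0 (s≤s z≤n)) (sumTo-offset i N (f ∘ suc) (λ k k<i → h (suc k) (s≤s k<i))) ⟩
  0ℚ + sumTo N (λ k → f (suc (i ℕ.+ k))) ≡⟨ +-identityˡ _ ⟩
  sumTo N (λ k → f (suc i ℕ.+ k)) ∎
  where open ≡-Reasoning

sumTo-reverse : ∀ n (f : ℕ → ℚ) → sumTo n f ≡ sumTo n (λ i → f (n ∸ i))
sumTo-reverse zero f = refl
sumTo-reverse (suc n) f = begin
  sumTo n f + f (suc n) ≡⟨ +-comm (sumTo n f) (f (suc n)) ⟩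
  f (suc n) + sumTo n f ≡⟨ cong (f (suc n) +_) (sumTo-reverse n f) ⟩
  f (suc n) + sumTo n (λ i → f (n ∸ i)) ≡⟨ sym (sumTo-shift n (λ i → f (suc n ∸ i))) ⟩
  sumTo (suc n) (λ i → f (suc n ∸ i)) ∎
  where open ≡-Reasoning

double : ℕ → ℕ
double n = n ℕ.+ n

sumTo-even : ∀ r (f : ℕ → ℚ) → (∀ s → f (suc (double s)) ≡ 0ℚ) → sumTo (double r) f ≡ sumTo r (λ s → f (double s))
sumTo-even zero f h = refl
sumTo-even (suc r) f h = begin
  sumTo (suc r ℕ.+ suc r) f ≡⟨ cong (λ t → sumTo t f) (cong suc (ℕP.+-suc r r)) ⟩
  (sumTo (double r) f + f (suc (double r))) + f (suc (suc (double r)))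
    ≡⟨ cong₂ _+_ (cong₂ _+_ (sumTo-even r f h) (h r)) (cong f (cong suc (sym (ℕP.+-suc r r)))) ⟩
  (sumTo r (λ s → f (double s)) + 0ℚ) + f (double (suc r))
    ≡⟨ cong (_+ f (double (suc r))) (+-identityʳ (sumTo r (λ s → f (double s)))) ⟩
  sumTo (suc r) (λ s → f (double s)) ∎
  where open ≡-Reasoning

δ : ℕ → ℕ → ℚ
δ i j with i ℕ.≟ j
... | yes _ = 1ℚ
... | no _ = 0ℚ

δ-refl : ∀ i → δ i i ≡ 1ℚ
δ-refl i with i ℕ.≟ i
... | yes _ = refl
... | no ne = ⊥-elim (ne refl)

δ-ne : ∀ i j → i ≢ j → δ i j ≡ 0ℚ
δ-ne i j ne with i ℕ.≟ j
... | yes eq = ⊥-elim (ne eq)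
... | no _ = refl

sumTo-delta : ∀ n j (f : ℕ → ℚ) → j ≤ n → sumTo n (λ i → f i * δ i j) ≡ f j
sumTo-delta n j f j≤n = begin
  sumTo n (λ i → f i * δ i j) ≡⟨ cong (λ t → sumTo t (λ i → f i * δ i j)) (sym (ℕP.m+[n∸m]≡n j≤n)) ⟩
  sumTo (j ℕ.+ (n ∸ j)) (λ i → f i * δ i j) ≡⟨ sumTo-tail j (n ∸ j) _ (λ i j<i → off i j (ℕP.>⇒≢ j<i)) ⟩
  sumTo j (λ i → f i * δ i j) ≡⟨ diagonal j ⟩
  f j ∎
  where
  open ≡-Reasoning
  off : ∀ i m → i ≢ m → f i * δ i m ≡ 0ℚ
  off i m i≢m = trans (cong (f i *_) (δ-ne i m i≢m)) (*-zeroʳ (f i))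
  on : ∀ m → f m * δ m m ≡ f m
  on m = trans (cong (f m *_) (δ-refl m)) (*-identityʳ (f m))
  diagonal : ∀ m → sumTo m (λ i → f i * δ i m) ≡ f m
  diagonal zero = on 0
  diagonal (suc m) = begin
    sumTo m (λ i → f i * δ i (suc m)) + f (suc m) * δ (suc m) (suc m)
      ≡⟨ cong₂ _+_ (sumTo-zero m _ (λ i i≤m → off i (suc m) (ℕP.<⇒≢ (s≤s i≤m)))) (on (suc m)) ⟩
    0ℚ + f (suc m) ≡⟨ +-identityˡ (f (suc m)) ⟩
    f (suc m) ∎

double≡*2 : ∀ m → double m ≡ m ℕ.* 2
double≡*2 m = ((∀ m → m ℕ.+ m ≡ m ℕ.* 2) ∋ solve-∀) m

double-half : ∀ m → double m / 2 ≡ m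
double-half m = trans (cong (_/ 2) (double≡*2 m)) (m*n/n≡m m 2)

double-mod : ∀ m → double m % 2 ≡ 0
double-mod m = trans (cong (_% 2) (double≡*2 m)) (m*n%n≡0 m 2)

even⇒double : ∀ d → d % 2 ≡ 0 → d ≡ double (d / 2)
even⇒double d e = trans (m≡m%n+[m/n]*n d 2) (trans (cong (ℕ._+ (d / 2) ℕ.* 2) e) (sym (double≡*2 (d / 2))))

double≢odd : ∀ a b → double a ≢ suc (double b)
double≢odd zero b ()
double≢odd (suc a) zero eq = ℕP.0≢1+n (sym (trans (sym (ℕP.+-suc a a)) (ℕP.suc-injective eq)))
double≢odd (suc a) (suc b) eq = double≢odd a b
    (ℕP.suc-injective (ℕP.suc-injective
    (trans (trans (cong suc (sym (ℕP.+-suc a a))) eq) (cong (λ x → suc (suc x)) (ℕP.+-suc b b)))))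

parity : ∀ d → Σ ℕ (λ r → d ≡ double r) ⊎ Σ ℕ (λ r → d ≡ suc (double r))
parity zero = inj₁ (0 , refl)
parity (suc zero) = inj₂ (0 , refl)
parity (suc (suc d)) with parity d
... | inj₁ (r , e) = inj₁ (suc r , trans (cong (λ x → suc (suc x)) e) (cong suc (sym (ℕP.+-suc r r))))
... | inj₂ (r , e) = inj₂ (suc r , trans (cong (λ x → suc (suc x)) e) (cong (λ x → suc (suc x)) (sym (ℕP.+-suc r r))))

half : ℕ → Maybe ℕ
half zero = just zero
half (suc zero) = nothing
half (suc (suc n)) = Maybe.map suc (half n)

half-just : ∀ n p → half n ≡ just p → n ≡ double p
half-just zero .zero refl = refl
half-just (suc zero) p ()
half-just (suc (suc n)) p eq with half n in e
half-just (suc (suc n)) .(suc q) refl | just q = cong suc (trans (cong suc (half-just n q e)) (sym (ℕP.+-suc q q)))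

half-double : ∀ p → half (double p) ≡ just p
half-double zero = refl
half-double (suc p) rewrite ℕP.+-suc p p | half-double p = refl

half-odd : ∀ p → half (suc (double p)) ≡ nothing
half-odd zero = refl
half-odd (suc p) rewrite ℕP.+-suc p p | half-odd p = refl

nth-padd : ∀ p q i → nth (padd p q) i ≡ nth p i + nth q i
nth-padd [] q i = sym (+-identityˡ _)
nth-padd (a ∷ p) [] i = sym (+-identityʳ _)
nth-padd (a ∷ p) (b ∷ q) zero = refl
nth-padd (a ∷ p) (b ∷ q) (suc i) = nth-padd p q i

nth-pscale : ∀ c p i → nth (pscale c p) i ≡ c * nth p i
nth-pscale c [] i = sym (*-zeroʳ c)
nth-pscale c (a ∷ p) zero = refl
nth-pscale c (a ∷ p) (suc i) = nth-pscale c p i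

nth-derivAux : ∀ m p i → nth (derivAux m p) i ≡ ι (m ℕ.+ i) * nth p i
nth-derivAux m [] i = sym (*-zeroʳ (ι (m ℕ.+ i)))
nth-derivAux m (b ∷ p) zero = cong (λ t → ι t * b) (sym (ℕP.+-identityʳ m))
nth-derivAux m (b ∷ p) (suc i) = trans (nth-derivAux (suc m) p i) (cong (λ t → ι t * nth p i) (sym (ℕP.+-suc m i)))

nth-pderiv : ∀ p i → nth (pderiv p) i ≡ ι (suc i) * nth p (suc i)
nth-pderiv [] i = sym (*-zeroʳ (ι (suc i)))
nth-pderiv (a ∷ p) i = nth-derivAux 1 p i

rising : ℕ → ℕ → ℕ
rising i zero = 1
rising i (suc k) = rising i k ℕ.* suc (i ℕ.+ k)

nth-pderivN : ∀ k p i → nth (pderivN k p) i ≡ ι (rising i k) * nth p (i ℕ.+ k)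
nth-pderivN zero p i = trans (sym (*-identityˡ (nth p i))) (cong (λ t → 1ℚ * nth p t) (sym (ℕP.+-identityʳ i)))
nth-pderivN (suc k) p i = begin
  nth (pderivN k (pderiv p)) i ≡⟨ nth-pderivN k (pderiv p) i ⟩
  ι (rising i k) * nth (pderiv p) (i ℕ.+ k) ≡⟨ cong (ι (rising i k) *_) (nth-pderiv p (i ℕ.+ k)) ⟩
  ι (rising i k) * (ι (suc (i ℕ.+ k)) * nth p (suc (i ℕ.+ k)))
    ≡⟨ sym (*-assoc (ι (rising i k)) (ι (suc (i ℕ.+ k))) (nth p (suc (i ℕ.+ k)))) ⟩
  (ι (rising i k) * ι (suc (i ℕ.+ k))) * nth p (suc (i ℕ.+ k))
    ≡⟨ cong₂ _*_ (sym (ι-* (rising i k) _)) (cong (nth p) (sym (ℕP.+-suc i k))) ⟩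
  ι (rising i (suc k)) * nth p (i ℕ.+ suc k) ∎
  where open ≡-Reasoning

rising-fact : ∀ i k → rising i k ℕ.* i ! ≡ (i ℕ.+ k) !
rising-fact i zero = trans (ℕP.+-identityʳ (i !)) (cong _! (sym (ℕP.+-identityʳ i)))
rising-fact i (suc k) = begin
  rising i k ℕ.* suc (i ℕ.+ k) ℕ.* i !
    ≡⟨ ((∀ a b c → a ℕ.* b ℕ.* c ≡ b ℕ.* (a ℕ.* c)) ∋ solve-∀) (rising i k) (suc (i ℕ.+ k)) (i !) ⟩
  suc (i ℕ.+ k) ℕ.* (rising i k ℕ.* i !) ≡⟨ cong (suc (i ℕ.+ k) ℕ.*_) (rising-fact i k) ⟩
  suc (i ℕ.+ k) ! ≡⟨ cong _! (sym (ℕP.+-suc i k)) ⟩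
  (i ℕ.+ suc k) ! ∎
  where open ≡-Reasoning

binomial-fact : ∀ a b → ((a ℕ.+ b) C a) ℕ.* (a ! ℕ.* b !) ≡ (a ℕ.+ b) !
binomial-fact a b = begin
  ((a ℕ.+ b) C a) ℕ.* (a ! ℕ.* b !) ≡⟨ cong (λ x → ((a ℕ.+ b) C a) ℕ.* (a ! ℕ.* x !)) (sym (ℕP.m+n∸m≡n a b)) ⟩
  ((a ℕ.+ b) C a) ℕ.* (a ! ℕ.* ((a ℕ.+ b) ∸ a) !)
    ≡⟨ cong (ℕ._* (a ! ℕ.* ((a ℕ.+ b) ∸ a) !)) (nCk≡n!/k![n-k]! (ℕP.m≤m+n a b)) ⟩
  ((a ℕ.+ b) ! / (a ! ℕ.* ((a ℕ.+ b) ∸ a) !)) {{nz}} ℕ.* (a ! ℕ.* ((a ℕ.+ b) ∸ a) !)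
    ≡⟨ m/n*n≡m {{nz}} (k![n∸k]!∣n! (ℕP.m≤m+n a b)) ⟩
  (a ℕ.+ b) ! ∎
  where
  open ≡-Reasoning
  nz : NonZero (a ! ℕ.* ((a ℕ.+ b) ∸ a) !)
  nz = ℕP.m*n≢0 _ _ {{a ℕP.!≢0}} {{((a ℕ.+ b) ∸ a) ℕP.!≢0}}

peval-zero : ∀ p x → (∀ i → nth p i ≡ 0ℚ) → peval p x ≡ 0ℚ
peval-zero [] x h = refl
peval-zero (a ∷ p) x h = begin
  a + x * peval p x ≡⟨ cong₂ (λ u v → u + x * v) (h 0) (peval-zero p x (h ∘ suc)) ⟩
  0ℚ + x * 0ℚ ≡⟨ solve 1 (λ x → con 0ℚ :+ x :* con 0ℚ := con 0ℚ) refl x ⟩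
  0ℚ ∎
  where open ≡-Reasoning

peval-sum : ∀ p M x → (∀ i → M < i → nth p i ≡ 0ℚ) → peval p x ≡ sumTo M (λ i → nth p i * pow x i)
peval-sum [] M x h = sym (sumTo-zero M _ (λ k _ → *-zeroˡ (pow x k)))
peval-sum (a ∷ p) zero x h = begin
  a + x * peval p x ≡⟨ cong (λ v → a + x * v) (peval-zero p x (λ i → h (suc i) (s≤s z≤n))) ⟩
  a + x * 0ℚ ≡⟨ solve 2 (λ a x → a :+ x :* con 0ℚ := a :* con 1ℚ) refl a x ⟩
  a * 1ℚ ∎
  where open ≡-Reasoning
peval-sum (a ∷ p) (suc M) x h = begin
  a + x * peval p x ≡⟨ cong (λ v → a + x * v) (peval-sum p M x (λ i M<i → h (suc i) (s≤s M<i))) ⟩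
  a + x * sumTo M (λ i → nth p i * pow x i) ≡⟨ cong (a +_) (sumTo-*l M x _) ⟩
  a + sumTo M (λ i → x * (nth p i * pow x i))
    ≡⟨ cong₂ _+_ (sym (*-identityʳ a))
        (sumTo-cong M (λ i _ → solve 3 (λ x c y → x :* (c :* y) := c :* (x :* y)) refl x (nth p i) (pow x i))) ⟩
  a * 1ℚ + sumTo M (λ i → nth p i * pow x (suc i)) ≡⟨ sym (sumTo-shift M (λ i → nth (a ∷ p) i * pow x i)) ⟩
  sumTo (suc M) (λ i → nth (a ∷ p) i * pow x i) ∎
  where open ≡-Reasoning

-- The coefficients of (x² - 1)^k: the coefficient of x^{2p} is (-1)^{k-p} C(k,p),
-- and odd coefficients vanish.  They are established through the recursion
-- (x² - 1)^{k+1} = -(x² - 1)^k + x²(x² - 1)^k, i.e. Pascal's rule.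

sqMinusOne : Poly
sqMinusOne = - 1ℚ ∷ 0ℚ ∷ 1ℚ ∷ []

shift2 : Poly → ℕ → ℚ
shift2 r zero = 0ℚ
shift2 r (suc zero) = 0ℚ
shift2 r (suc (suc i)) = nth r i

nth-mul-sqMinusOne : ∀ r i → nth (pmul sqMinusOne r) i ≡ - nth r i + shift2 r i
nth-mul-sqMinusOne r zero = begin
  nth (padd (pscale (- 1ℚ) r) _) 0 ≡⟨ nth-padd (pscale (- 1ℚ) r) _ 0 ⟩
  nth (pscale (- 1ℚ) r) 0 + 0ℚ ≡⟨ cong (_+ 0ℚ) (nth-pscale (- 1ℚ) r 0) ⟩
  - 1ℚ * nth r 0 + 0ℚ ≡⟨ cong (_+ 0ℚ) (sym (neg-distribˡ-* 1ℚ (nth r 0))) ⟩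
  - (1ℚ * nth r 0) + 0ℚ ≡⟨ cong (λ t → - t + 0ℚ) (*-identityˡ (nth r 0)) ⟩
  - nth r 0 + 0ℚ ∎
  where open ≡-Reasoning
nth-mul-sqMinusOne r (suc i) = begin
  nth (padd (pscale (- 1ℚ) r) _) (suc i) ≡⟨ nth-padd (pscale (- 1ℚ) r) _ (suc i) ⟩
  nth (pscale (- 1ℚ) r) (suc i) + nth (padd (pscale 0ℚ r) (0ℚ ∷ padd (pscale 1ℚ r) (0ℚ ∷ pmul [] r))) i
    ≡⟨ cong₂ _+_ (nth-pscale (- 1ℚ) r (suc i)) (nth-padd (pscale 0ℚ r) _ i) ⟩
  - 1ℚ * nth r (suc i) + (nth (pscale 0ℚ r) i + nth (0ℚ ∷ padd (pscale 1ℚ r) (0ℚ ∷ [])) i)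
    ≡⟨ cong₂ _+_ (trans (sym (neg-distribˡ-* 1ℚ (nth r (suc i)))) (cong -_ (*-identityˡ (nth r (suc i)))))
        (cong₂ _+_ (trans (nth-pscale 0ℚ r i) (*-zeroˡ (nth r i))) refl) ⟩
  - nth r (suc i) + (0ℚ + nth (0ℚ ∷ padd (pscale 1ℚ r) (0ℚ ∷ [])) i)
    ≡⟨ cong ((- nth r (suc i)) +_) (trans (+-identityˡ (nth (0ℚ ∷ padd (pscale 1ℚ r) (0ℚ ∷ [])) i)) (tail i)) ⟩
  - nth r (suc i) + shift2 r (suc i) ∎
  where
  open ≡-Reasoning
  tail : ∀ i → nth (0ℚ ∷ padd (pscale 1ℚ r) (0ℚ ∷ [])) i ≡ shift2 r (suc i)
  tail zero = refl
  tail (suc i) = trans (nth-padd (pscale 1ℚ r) _ i)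
      (trans (cong₂ _+_ (trans (nth-pscale 1ℚ r i) (*-identityˡ (nth r i))) (nil i)) (+-identityʳ (nth r i)))
    where
    nil : ∀ i → nth (0ℚ ∷ []) i ≡ 0ℚ
    nil zero = refl
    nil (suc i) = refl

sign : ℕ → ℚ
sign s = pow (- 1ℚ) s

evenCoeff : ℕ → ℕ → ℚ
evenCoeff k p = sign (k ∸ p) * ι (k C p)

sqPowCoeff : ℕ → ℕ → ℚ
sqPowCoeff k n = maybe (evenCoeff k) 0ℚ (half n)

∸-suc : ∀ k p → p < k → k ∸ p ≡ suc (k ∸ suc p)
∸-suc (suc k) zero _ = refl
∸-suc (suc k) (suc p) (s≤s p<k) = ∸-suc k p p<k

evenCoeff-step-cases : ∀ k p → Tri (p < k) (p ≡ k) (k < p) →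
  evenCoeff (suc k) (suc p) ≡ - evenCoeff k (suc p) + evenCoeff k p
evenCoeff-step-cases k p (tri< p<k _ _) = begin
  sign (k ∸ p) * ι (suc k C suc p) ≡⟨ cong (λ t → sign (k ∸ p) * ι t) (sym (nCk+nC[k+1]≡[n+1]C[k+1] k p)) ⟩
  sign (k ∸ p) * ι (k C p ℕ.+ k C suc p) ≡⟨ cong (sign (k ∸ p) *_) (ι-+ (k C p) _) ⟩
  sign (k ∸ p) * (ι (k C p) + ι (k C suc p))
    ≡⟨ cong (λ t → sign t * (ι (k C p) + ι (k C suc p))) (∸-suc k p p<k) ⟩
  (- 1ℚ * sign (k ∸ suc p)) * (ι (k C p) + ι (k C suc p))
    ≡⟨ solve 3 (λ s a b → (:- con 1ℚ :* s) :* (a :+ b) := :- (s :* b) :+ (:- con 1ℚ :* s) :* a) refl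
        (sign (k ∸ suc p)) (ι (k C p)) (ι (k C suc p)) ⟩
  - (sign (k ∸ suc p) * ι (k C suc p)) + (- 1ℚ * sign (k ∸ suc p)) * ι (k C p)
    ≡⟨ cong (λ t → - (sign (k ∸ suc p) * ι (k C suc p)) + sign t * ι (k C p)) (sym (∸-suc k p p<k)) ⟩
  - evenCoeff k (suc p) + evenCoeff k p ∎
  where open ≡-Reasoning
evenCoeff-step-cases k p (tri≈ _ refl _) = begin
  sign (p ∸ p) * ι (suc p C suc p) ≡⟨ cong (λ t → sign (p ∸ p) * ι t) (sym (nCk+nC[k+1]≡[n+1]C[k+1] p p)) ⟩
  sign (p ∸ p) * ι (p C p ℕ.+ p C suc p)
    ≡⟨ cong (λ t → sign (p ∸ p) * ι (p C p ℕ.+ t)) (k>n⇒nCk≡0 (ℕP.n<1+n p)) ⟩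
  sign (p ∸ p) * ι (p C p ℕ.+ 0) ≡⟨ cong (λ t → sign (p ∸ p) * ι t) (ℕP.+-identityʳ (p C p)) ⟩
  sign (p ∸ p) * ι (p C p) ≡⟨ solve 2 (λ a b → a := :- (b :* con 0ℚ) :+ a) refl _ (sign (p ∸ suc p)) ⟩
  - (sign (p ∸ suc p) * ι 0) + evenCoeff p p
    ≡⟨ cong (λ t → - (sign (p ∸ suc p) * ι t) + evenCoeff p p) (sym (k>n⇒nCk≡0 (ℕP.n<1+n p))) ⟩
  - evenCoeff p (suc p) + evenCoeff p p ∎
  where open ≡-Reasoning
evenCoeff-step-cases k p (tri> _ _ k<p) = begin
  sign (k ∸ p) * ι (suc k C suc p) ≡⟨ cong (λ t → sign (k ∸ p) * ι t) (k>n⇒nCk≡0 (s≤s k<p)) ⟩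
  sign (k ∸ p) * ι 0
    ≡⟨ solve 3 (λ a b c → a :* con 0ℚ := :- (b :* con 0ℚ) :+ c :* con 0ℚ) refl (sign (k ∸ p)) (sign (k ∸ suc p))
        (sign (k ∸ p)) ⟩
  - (sign (k ∸ suc p) * ι 0) + sign (k ∸ p) * ι 0
    ≡⟨ cong₂ (λ u v → - (sign (k ∸ suc p) * ι u) + sign (k ∸ p) * ι v) (sym (k>n⇒nCk≡0 (ℕP.m<n⇒m<1+n k<p)))
        (sym (k>n⇒nCk≡0 k<p)) ⟩
  - evenCoeff k (suc p) + evenCoeff k p ∎
  where open ≡-Reasoning

evenCoeff-step : ∀ k p → evenCoeff (suc k) (suc p) ≡ - evenCoeff k (suc p) + evenCoeff k p
evenCoeff-step k p = evenCoeff-step-cases k p (ℕP.<-cmp p k)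

sqPowCoeff-shift2 : ℕ → ℕ → ℚ
sqPowCoeff-shift2 k zero = 0ℚ
sqPowCoeff-shift2 k (suc zero) = 0ℚ
sqPowCoeff-shift2 k (suc (suc n)) = sqPowCoeff k n

-- The coefficient recursion coming from (x² - 1)^{k+1} = (x² - 1)(x² - 1)^k.
sqPowCoeff-step : ∀ k n → sqPowCoeff (suc k) n ≡ - sqPowCoeff k n + sqPowCoeff-shift2 k n
sqPowCoeff-step k zero = solve 1 (λ s → (:- con 1ℚ :* s) :* con 1ℚ := :- (s :* con 1ℚ) :+ con 0ℚ) refl (sign k)
sqPowCoeff-step k (suc zero) = refl
sqPowCoeff-step k (suc (suc n)) = lift k (half n)
  where
  lift : ∀ k m → maybe (evenCoeff (suc k)) 0ℚ (Maybe.map suc m) ≡ - maybe (evenCoeff k) 0ℚ (Maybe.map suc m) +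
      maybe (evenCoeff k) 0ℚ m
  lift k nothing = refl
  lift k (just p) = evenCoeff-step k p

nth-sqPow : ∀ k n → nth (ppow sqMinusOne k) n ≡ sqPowCoeff k n
nth-sqPow zero zero = refl
nth-sqPow zero (suc zero) = refl
nth-sqPow zero (suc (suc n)) = vanishing (half n)
  where
  vanishing : ∀ m → 0ℚ ≡ maybe (evenCoeff 0) 0ℚ (Maybe.map suc m)
  vanishing nothing = refl
  vanishing (just p) = refl
nth-sqPow (suc k) n = begin
  nth (pmul sqMinusOne (ppow sqMinusOne k)) n ≡⟨ nth-mul-sqMinusOne (ppow sqMinusOne k) n ⟩
  - nth (ppow sqMinusOne k) n + shift2 (ppow sqMinusOne k) n ≡⟨ cong₂ _+_ (cong -_ (nth-sqPow k n)) (shifted n) ⟩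
  - sqPowCoeff k n + sqPowCoeff-shift2 k n ≡⟨ sym (sqPowCoeff-step k n) ⟩
  sqPowCoeff (suc k) n ∎
  where
  open ≡-Reasoning
  shifted : ∀ n → shift2 (ppow sqMinusOne k) n ≡ sqPowCoeff-shift2 k n
  shifted zero = refl
  shifted (suc zero) = refl
  shifted (suc (suc n)) = nth-sqPow k n

sqPowCoeff-big-cases : ∀ k n → double k < n → ∀ m → half n ≡ m → maybe (evenCoeff k) 0ℚ m ≡ 0ℚ
sqPowCoeff-big-cases k n lt nothing e = refl
sqPowCoeff-big-cases k n lt (just p) e = begin
  sign (k ∸ p) * ι (k C p) ≡⟨ cong (λ t → sign (k ∸ p) * ι t) (k>n⇒nCk≡0 (k<p (ℕP.<-cmp k p))) ⟩
  sign (k ∸ p) * 0ℚ ≡⟨ *-zeroʳ (sign (k ∸ p)) ⟩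
  0ℚ ∎
  where
  open ≡-Reasoning
  k<p : Tri (k < p) (k ≡ p) (p < k) → k < p
  k<p (tri< a _ _) = a
  k<p (tri≈ _ refl _) = ⊥-elim (ℕP.<-irrefl (sym (half-just n p e)) lt)
  k<p (tri> _ _ p<k) = ⊥-elim (ℕP.<-asym lt (subst (_< double k) (sym (half-just n p e)) (ℕP.+-mono-< p<k p<k)))

sqPowCoeff-big : ∀ k n → double k < n → sqPowCoeff k n ≡ 0ℚ
sqPowCoeff-big k n lt = sqPowCoeff-big-cases k n lt (half n) refl

-- The monomial coefficients of the Legendre polynomials, from Rodrigues' formula:
-- legendreMono k i = (1/(k! 2^k)) · (i+1)⋯(i+k) · [x^{i+k}] (x² - 1)^k.

rodriguesScale : ℕ → ℚ
rodriguesScale k = ((ℤ.+ 1) ℚ./ (k ! ℕ.* 2 ℕ.^ k)) {{ℕP.m*n≢0 (k !) (2 ℕ.^ k) {{k ℕP.!≢0}} {{ℕP.m^n≢0 2 k}}}}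

legendreMono : ℕ → ℕ → ℚ
legendreMono k i = rodriguesScale k * (ι (rising i k) * sqPowCoeff k (i ℕ.+ k))

legendre-sum : ∀ k x → legendre k x ≡ sumTo k (λ i → legendreMono k i * pow x i)
legendre-sum k x = begin
  rodriguesScale k * peval (pderivN k (ppow sqMinusOne k)) x
    ≡⟨ cong (rodriguesScale k *_) (peval-sum (pderivN k (ppow sqMinusOne k)) k x vanish) ⟩
  rodriguesScale k * sumTo k (λ i → nth (pderivN k (ppow sqMinusOne k)) i * pow x i)
    ≡⟨ sumTo-*l k (rodriguesScale k) (λ i → nth (pderivN k (ppow sqMinusOne k)) i * pow x i) ⟩
  sumTo k (λ i → rodriguesScale k * (nth (pderivN k (ppow sqMinusOne k)) i * pow x i))
    ≡⟨ sumTo-cong k (λ i _ → trans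
        (cong (λ t → rodriguesScale k * (t * pow x i))
        (trans (nth-pderivN k _ i) (cong (ι (rising i k) *_) (nth-sqPow k (i ℕ.+ k)))))
        (sym (*-assoc (rodriguesScale k) _ _))) ⟩
  sumTo k (λ i → legendreMono k i * pow x i) ∎
  where
  open ≡-Reasoning
  vanish : ∀ i → k < i → nth (pderivN k (ppow sqMinusOne k)) i ≡ 0ℚ
  vanish i k<i = trans (nth-pderivN k _ i)
      (trans (cong (ι (rising i k) *_)
      (trans (nth-sqPow k (i ℕ.+ k))
      (sqPowCoeff-big k (i ℕ.+ k) (subst (_< i ℕ.+ k) (ℕP.+-comm k k) (ℕP.+-monoˡ-< k k<i)))))
      (*-zeroʳ (ι (rising i k))))

legendreMono-big : ∀ k i → k < i → legendreMono k i ≡ 0ℚ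
legendreMono-big k i k<i = trans
    (cong (λ t → rodriguesScale k * (ι (rising i k) * t))
    (sqPowCoeff-big k (i ℕ.+ k) (subst (_< i ℕ.+ k) (ℕP.+-comm k k) (ℕP.+-monoˡ-< k k<i))))
    (solve 2 (λ a b → a :* (b :* con 0ℚ) := con 0ℚ) refl (rodriguesScale k) (ι (rising i k)))

legendre-ext : ∀ n k x → k ≤ n → legendre k x ≡ sumTo n (λ i → legendreMono k i * pow x i)
legendre-ext n k x k≤n = begin
  legendre k x ≡⟨ legendre-sum k x ⟩
  sumTo k (λ i → legendreMono k i * pow x i)
    ≡⟨ sym (sumTo-tail k (n ∸ k) _
        (λ i k<i → trans (cong (_* pow x i) (legendreMono-big k i k<i)) (*-zeroˡ (pow x i)))) ⟩
  sumTo (k ℕ.+ (n ∸ k)) (λ i → legendreMono k i * pow x i)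
    ≡⟨ cong (λ m → sumTo m (λ i → legendreMono k i * pow x i)) (ℕP.m+[n∸m]≡n k≤n) ⟩
  sumTo n (λ i → legendreMono k i * pow x i) ∎
  where open ≡-Reasoning

legendreMono-view : ∀ k i → (Σ ℕ (λ p → i ℕ.+ k ≡ double p) × i ≤ k) ⊎ legendreMono k i ≡ 0ℚ
legendreMono-view k i with i ≤? k
... | no i≰k = inj₂ (legendreMono-big k i (ℕP.≰⇒> i≰k))
... | yes i≤k with half (i ℕ.+ k) in e
...   | nothing = inj₂ (solve 2 (λ a b → a :* (b :* con 0ℚ) := con 0ℚ) refl (rodriguesScale k) (ι (rising i k)))
...   | just p = inj₁ ((p , half-just _ p e) , i≤k)

rodriguesScale-frac : ∀ k → rodriguesScale k ≡ frac 1 (k ! ℕ.* 2 ℕ.^ k)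
rodriguesScale-frac k = divℚ≡frac 1 (k ! ℕ.* 2 ℕ.^ k) {{ℕP.m*n≢0 (k !) (2 ℕ.^ k) {{k ℕP.!≢0}} {{ℕP.m^n≢0 2 k}}}}

legendreMono-explicit : ∀ i s →
  legendreMono (i ℕ.+ double s) i
    ≡ rodriguesScale (i ℕ.+ double s) * (ι (rising i (i ℕ.+ double s)) * (sign s * ι ((i ℕ.+ double s) C (i ℕ.+ s))))
legendreMono-explicit i s = cong (λ x → rodriguesScale k * (ι (rising i k) * x))
    (trans (cong (maybe (evenCoeff k) 0ℚ) (trans (cong half e1) (half-double (i ℕ.+ s))))
    (cong (λ x → sign x * ι (k C (i ℕ.+ s))) e2))
  where
  k = i ℕ.+ double s
  e1 : i ℕ.+ k ≡ double (i ℕ.+ s)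
  e1 = ((∀ i s → i ℕ.+ (i ℕ.+ (s ℕ.+ s)) ≡ (i ℕ.+ s) ℕ.+ (i ℕ.+ s)) ∋ solve-∀) i s
  e2 : k ∸ (i ℕ.+ s) ≡ s
  e2 = trans (cong (_∸ (i ℕ.+ s)) (sym (ℕP.+-assoc i s s))) (ℕP.m+n∸m≡n (i ℕ.+ s) s)

-- The coefficient of P_k in the monomial x^j is weight k · monoFactor j k, where
-- weight k = 2^{k+2} k + 2^{k+1} and monoFactor j k is the factorial quotient of the
-- theorem (0 unless k ≤ j and j ≡ k mod 2).

weight : ℕ → ℚ
weight k = ι (2 ℕ.^ (k ℕ.+ 2) ℕ.* k ℕ.+ 2 ℕ.^ (k ℕ.+ 1))

-- The same case distinction as Defs.innerTerm, without the factor C(n,j) B_{n-j}.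
monoFactor : ℕ → ℕ → ℚ
monoFactor j k with k ≤? j | (j ∸ k) % 2
... | yes _ | zero = frac (j ! ℕ.* ((j ℕ.+ k ℕ.+ 2) / 2) !) (((j ∸ k) / 2) ! ℕ.* (j ℕ.+ k ℕ.+ 2) !)
... | yes _ | suc _ = 0ℚ
... | no _ | _ = 0ℚ

innerTerm-factor : ∀ J Cn H D B .{{_ : NonZero D}} → D ≢ 0 → divℚ (J ℕ.* Cn ℕ.* H) D * B ≡ ι Cn * B * frac (J ℕ.* H) D
innerTerm-factor J Cn H D B dnz = begin
  divℚ (J ℕ.* Cn ℕ.* H) D * B ≡⟨ cong (_* B) (divℚ≡frac _ D) ⟩
  frac (J ℕ.* Cn ℕ.* H) D * B
    ≡⟨ cong (_* B) (frac-cross (J ℕ.* Cn ℕ.* H) D (Cn ℕ.* (J ℕ.* H)) (1 ℕ.* D) dnz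
        (λ e → dnz (trans (sym (ℕP.*-identityˡ D)) e)) eqn) ⟩
  frac (Cn ℕ.* (J ℕ.* H)) (1 ℕ.* D) * B ≡⟨ cong (_* B) (sym (frac-mul Cn 1 (J ℕ.* H) D)) ⟩
  (ι Cn * frac (J ℕ.* H) D) * B
    ≡⟨ solve 3 (λ a b c → (a :* b) :* c := a :* c :* b) refl (ι Cn) (frac (J ℕ.* H) D) B ⟩
  ι Cn * B * frac (J ℕ.* H) D ∎
  where
  open ≡-Reasoning
  eqn : J ℕ.* Cn ℕ.* H ℕ.* (1 ℕ.* D) ≡ Cn ℕ.* (J ℕ.* H) ℕ.* D
  eqn = ((∀ a b c d → a ℕ.* b ℕ.* c ℕ.* (1 ℕ.* d) ≡ b ℕ.* (a ℕ.* c) ℕ.* d) ∋ solve-∀) J Cn H D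

innerTerm-split : ∀ n k j → innerTerm n k j ≡ ι (n C j) * bernoulliNumber (n ∸ j) * monoFactor j k
innerTerm-split n k j with k ≤? j | (j ∸ k) % 2
... | yes _ | zero = innerTerm-factor (j !) (n C j) (((j ℕ.+ k ℕ.+ 2) / 2) !)
    (((j ∸ k) / 2) ! ℕ.* (j ℕ.+ k ℕ.+ 2) !) (bernoulliNumber (n ∸ j))
                       {{ℕP.m*n≢0 (((j ∸ k) / 2) !) ((j ℕ.+ k ℕ.+ 2) !) {{((j ∸ k) / 2) ℕP.!≢0}}
                           {{(j ℕ.+ k ℕ.+ 2) ℕP.!≢0}}}}
                       (fact≢0 ((j ∸ k) / 2) *≢0 fact≢0 (j ℕ.+ k ℕ.+ 2))
... | yes _ | suc _ = sym (*-zeroʳ (ι (n C j) * bernoulliNumber (n ∸ j)))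
... | no _ | _ = sym (*-zeroʳ (ι (n C j) * bernoulliNumber (n ∸ j)))

monoFactor-view : ∀ j k → Σ ℕ (λ m → j ≡ k ℕ.+ double m) ⊎ monoFactor j k ≡ 0ℚ
monoFactor-view j k with k ≤? j | (j ∸ k) % 2 in e
... | yes k≤j | zero = inj₁ ((j ∸ k) / 2 , trans (sym (ℕP.m+[n∸m]≡n k≤j)) (cong (k ℕ.+_) (even⇒double (j ∸ k) e)))
... | yes _ | suc _ = inj₂ refl
... | no _ | _ = inj₂ refl

monoFactor-explicit : ∀ k t →
  monoFactor (k ℕ.+ double t) k
    ≡ frac ((k ℕ.+ double t) ! ℕ.* (suc (k ℕ.+ t)) !) (t ! ℕ.* (suc (suc ((k ℕ.+ double t) ℕ.+ k))) !)
monoFactor-explicit k t with k ≤? (k ℕ.+ double t) | (k ℕ.+ double t ∸ k) % 2 in e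
... | yes _ | zero = frac-cong (cong (λ x → (k ℕ.+ double t) ! ℕ.* x !) e1) (cong₂ (λ x y → x ! ℕ.* y !) e2 e3)
  where
  e3 : k ℕ.+ double t ℕ.+ k ℕ.+ 2 ≡ suc (suc ((k ℕ.+ double t) ℕ.+ k))
  e3 = ℕP.+-comm _ 2
  e1 : (k ℕ.+ double t ℕ.+ k ℕ.+ 2) / 2 ≡ suc (k ℕ.+ t)
  e1 = trans (cong (_/ 2) (((∀ k t → k ℕ.+ (t ℕ.+ t) ℕ.+ k ℕ.+ 2 ≡ (1 ℕ.+ (k ℕ.+ t)) ℕ.+ (1 ℕ.+ (k ℕ.+ t))) ∋
      solve-∀) k t)) (double-half (suc (k ℕ.+ t)))
  e2 : (k ℕ.+ double t ∸ k) / 2 ≡ t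
  e2 = trans (cong (_/ 2) (ℕP.m+n∸m≡n k (double t))) (double-half t)
... | yes _ | suc _ = ⊥-elim (ℕP.0≢1+n
    (trans (sym (double-mod t)) (trans (cong (_% 2) (sym (ℕP.m+n∸m≡n k (double t)))) e)))
... | no k≰ | _ = ⊥-elim (k≰ (ℕP.m≤m+n k (double t)))

-- The entries of the product of the two change-of-basis matrices,
--   transition j i k = c(j,k) · legendreMono k i,
-- and, for k = i + 2s, j = k + 2t, their closed form
--   orthoTerm i s t = (-1)^s · 2(2k+1) j! (k+t+1)! (2(i+s))! / (t! (j+k+2)! s! (i+s)! i!).

transition : ℕ → ℕ → ℕ → ℚ
transition j i k = weight k * monoFactor j k * legendreMono k i

orthoNum : ℕ → ℕ → ℕ → ℕ
orthoNum i s t = 2 ℕ.* (1 ℕ.+ double (i ℕ.+ double s)) ℕ.* ((i ℕ.+ double s) ℕ.+ double t) ! ℕ.*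
    (suc ((i ℕ.+ double s) ℕ.+ t)) ! ℕ.* (double (i ℕ.+ s)) !

orthoDen : ℕ → ℕ → ℕ → ℕ
orthoDen i s t = t ! ℕ.* (suc (suc (((i ℕ.+ double s) ℕ.+ double t) ℕ.+ (i ℕ.+ double s)))) ! ℕ.* s ! ℕ.*
    (i ℕ.+ s) ! ℕ.* i !

orthoDen≢0 : ∀ i s t → orthoDen i s t ≢ 0
orthoDen≢0 i s t = fact≢0 t *≢0 fact≢0 (suc (suc (((i ℕ.+ double s) ℕ.+ double t) ℕ.+ (i ℕ.+ double s)))) *≢0
    fact≢0 s *≢0 fact≢0 (i ℕ.+ s) *≢0 fact≢0 i

orthoTerm : ℕ → ℕ → ℕ → ℚ
orthoTerm i s t = sign s * frac (orthoNum i s t) (orthoDen i s t)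

-- The cross-multiplied form of transition-explicit, with the factorials abstracted
-- to variables subject to the relations (i+k)! = rising i k · i! and k! = C(k,i+s) (i+s)! s!.
transition-explicit-nat : ∀ k P P4 P2 J H T Q K FF CC S U I M →
  P4 ≡ P ℕ.* 4 → P2 ≡ P ℕ.* 2 → FF ℕ.* I ≡ M → CC ℕ.* (U ℕ.* S) ≡ K →
  (P4 ℕ.* k ℕ.+ P2) ℕ.* (J ℕ.* H) ℕ.* 1 ℕ.* FF ℕ.* CC ℕ.* (T ℕ.* Q ℕ.* S ℕ.* U ℕ.* I)
  ≡ 2 ℕ.* (1 ℕ.+ double k) ℕ.* J ℕ.* H ℕ.* M ℕ.* (1 ℕ.* (T ℕ.* Q) ℕ.* (K ℕ.* P) ℕ.* 1 ℕ.* 1)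
transition-explicit-nat k P .(P ℕ.* 4) .(P ℕ.* 2) J H T Q .(CC ℕ.* (U ℕ.* S)) FF CC S U I .(FF ℕ.* I) refl refl
    refl refl =
  N.solve 11 (λ k P J H T Q FF CC S U I →
    (P N.:* N.con 4 N.:* k N.:+ P N.:* N.con 2) N.:* (J N.:* H) N.:* N.con 1 N.:* FF N.:* CC N.:*
        (T N.:* Q N.:* S N.:* U N.:* I)
    N.:= N.con 2 N.:* (N.con 1 N.:+ (k N.:+ k)) N.:* J N.:* H N.:* (FF N.:* I) N.:*
        (N.con 1 N.:* (T N.:* Q) N.:* ((CC N.:* (U N.:* S)) N.:* P) N.:* N.con 1 N.:* N.con 1))
    refl k P J H T Q FF CC S U I

transition-explicit : ∀ i s t →
  weight (i ℕ.+ double s) * monoFactor ((i ℕ.+ double s) ℕ.+ double t) (i ℕ.+ double s) * legendreMono (i ℕ.+ double s) i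
    ≡ orthoTerm i s t
transition-explicit i s t = begin
  weight k * monoFactor j k * legendreMono k i
    ≡⟨ cong₂ (λ x y → weight k * x * y) (monoFactor-explicit k t)
        (trans (legendreMono-explicit i s)
        (cong (_* (ι (rising i k) * (sign s * ι (k C (i ℕ.+ s))))) (rodriguesScale-frac k))) ⟩
  weight k * frac cn cd * (frac 1 KP * (ι (rising i k) * (sign s * ι (k C (i ℕ.+ s)))))
    ≡⟨ solve 6 (λ w c kp f σ b → w :* c :* (kp :* (f :* (σ :* b))) := σ :* ((((w :* c) :* kp) :* f) :* b)) refl
        (weight k) (frac cn cd) (frac 1 KP) (ι (rising i k)) (sign s) (ι (k C (i ℕ.+ s))) ⟩
  sign s * ((((frac W' 1 * frac cn cd) * frac 1 KP) * frac (rising i k) 1) * frac (k C (i ℕ.+ s)) 1)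
    ≡⟨ cong (sign s *_) (trans
        (cong (λ x → ((x * frac 1 KP) * frac (rising i k) 1) * frac (k C (i ℕ.+ s)) 1) (frac-mul W' 1 cn cd))
        (trans (cong (λ x → (x * frac (rising i k) 1) * frac (k C (i ℕ.+ s)) 1)
        (frac-mul (W' ℕ.* cn) (1 ℕ.* cd) 1 KP))
        (trans (cong (_* frac (k C (i ℕ.+ s)) 1) (frac-mul (W' ℕ.* cn ℕ.* 1) (1 ℕ.* cd ℕ.* KP) (rising i k) 1))
        (frac-mul (W' ℕ.* cn ℕ.* 1 ℕ.* rising i k) (1 ℕ.* cd ℕ.* KP ℕ.* 1) (k C (i ℕ.+ s)) 1)))) ⟩
  sign s * frac (W' ℕ.* cn ℕ.* 1 ℕ.* rising i k ℕ.* (k C (i ℕ.+ s))) (1 ℕ.* cd ℕ.* KP ℕ.* 1 ℕ.* 1)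
    ≡⟨ cong (sign s *_) (frac-cross _ _ _ _ dnz (orthoDen≢0 i s t) eqn) ⟩
  orthoTerm i s t ∎
  where
  open ≡-Reasoning
  k = i ℕ.+ double s
  j = k ℕ.+ double t
  W' = 2 ℕ.^ (k ℕ.+ 2) ℕ.* k ℕ.+ 2 ℕ.^ (k ℕ.+ 1)
  cn = j ! ℕ.* (suc (k ℕ.+ t)) !
  cd = t ! ℕ.* (suc (suc (j ℕ.+ k))) !
  KP = k ! ℕ.* 2 ℕ.^ k
  dnz : 1 ℕ.* cd ℕ.* KP ℕ.* 1 ℕ.* 1 ≢ 0
  dnz = suc≢0 0 *≢0 (fact≢0 t *≢0 fact≢0 (suc (suc (j ℕ.+ k)))) *≢0 (fact≢0 k *≢0 pow2≢0 k) *≢0 suc≢0 0 *≢0 suc≢0 0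
  e1 : i ℕ.+ k ≡ double (i ℕ.+ s)
  e1 = ((∀ i s → i ℕ.+ (i ℕ.+ (s ℕ.+ s)) ≡ (i ℕ.+ s) ℕ.+ (i ℕ.+ s)) ∋ solve-∀) i s
  e2 : (i ℕ.+ s) ℕ.+ s ≡ k
  e2 = ℕP.+-assoc i s s
  eqn : W' ℕ.* cn ℕ.* 1 ℕ.* rising i k ℕ.* (k C (i ℕ.+ s)) ℕ.* orthoDen i s t
        ≡ orthoNum i s t ℕ.* (1 ℕ.* cd ℕ.* KP ℕ.* 1 ℕ.* 1)
  eqn = transition-explicit-nat k (2 ℕ.^ k) (2 ℕ.^ (k ℕ.+ 2)) (2 ℕ.^ (k ℕ.+ 1)) (j !) ((suc (k ℕ.+ t)) !) (t !)
      ((suc (suc (j ℕ.+ k))) !) (k !) (rising i k) (k C (i ℕ.+ s)) (s !) ((i ℕ.+ s) !) (i !) ((double (i ℕ.+ s)) !)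
    (ℕP.^-distribˡ-+-* 2 k 2) (ℕP.^-distribˡ-+-* 2 k 1) (trans (rising-fact i k) (cong _! e1))
    (subst (λ x → (x C (i ℕ.+ s)) ℕ.* ((i ℕ.+ s) ! ℕ.* s !) ≡ x !) e2 (binomial-fact (i ℕ.+ s) s))

-- The
-- partial sums Σ_{u ≤ s} orthoTerm i u (s+1+t-u) have the closed form orthoPartial i s t
--   = (-1)^s · 2 j! (2(i+s)+1)! (i+(s+t+1)+s+1)! / ((s+t+1) t! s! (i+s)! (j+k+2)! i!)
-- with j = i + 2(s+t+1), k = i + 2s: the first partial sum is a single term
-- (partial-first), each further term extends it (partial-step), and the last term
-- cancels it (partial-last).  Each step is an identity of fractions whose
-- cross-multiplied form is a polynomial identity (the *-poly lemmas) multiplied by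
-- common factorials (the *-factor / *-nat lemmas).

partialNum : ℕ → ℕ → ℕ → ℕ
partialNum i s t = 2 ℕ.* (i ℕ.+ double (s ℕ.+ suc t)) ! ℕ.* (suc (double (i ℕ.+ s))) ! ℕ.*
    (suc (i ℕ.+ (s ℕ.+ suc t) ℕ.+ s)) !

partialDen : ℕ → ℕ → ℕ → ℕ
partialDen i s t = suc (s ℕ.+ t) ℕ.* t ! ℕ.* s ! ℕ.* (i ℕ.+ s) ! ℕ.*
    (suc (suc (double (i ℕ.+ (s ℕ.+ suc t) ℕ.+ s)))) ! ℕ.* i !

partialDen≢0 : ∀ i s t → partialDen i s t ≢ 0
partialDen≢0 i s t = suc≢0 (s ℕ.+ t) *≢0 fact≢0 t *≢0 fact≢0 s *≢0 fact≢0 (i ℕ.+ s) *≢0 fact≢0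
    (suc (suc (double (i ℕ.+ (s ℕ.+ suc t) ℕ.+ s)))) *≢0 fact≢0 i

orthoPartial : ℕ → ℕ → ℕ → ℚ
orthoPartial i s t = sign s * frac (partialNum i s t) (partialDen i s t)

partial-first-nat : ∀ i t J a0 b c f0 g I JT BT GT → JT ≡ J → BT ≡ b → GT ≡ g →
  (2 ℕ.* (1 ℕ.+ double (i ℕ.+ 0)) ℕ.* JT ℕ.* BT ℕ.* a0) ℕ.* (suc t ℕ.* c ℕ.* 1 ℕ.* f0 ℕ.* g ℕ.* I)
  ≡ (2 ℕ.* J ℕ.* (suc (double (i ℕ.+ 0)) ℕ.* a0) ℕ.* b) ℕ.* ((suc t ℕ.* c) ℕ.* GT ℕ.* 1 ℕ.* f0 ℕ.* I)
partial-first-nat i t J a0 b c f0 g I _ _ _ refl refl refl =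
  N.solve 9 (λ i t J a0 b c f0 g I →
    (N.con 2 N.:* (N.con 1 N.:+ ((i N.:+ N.con 0) N.:+ (i N.:+ N.con 0))) N.:* J N.:* b N.:* a0) N.:*
        ((N.con 1 N.:+ t) N.:* c N.:* N.con 1 N.:* f0 N.:* g N.:* I)
    N.:= (N.con 2 N.:* J N.:* ((N.con 1 N.:+ ((i N.:+ N.con 0) N.:+ (i N.:+ N.con 0))) N.:* a0) N.:* b) N.:*
        (((N.con 1 N.:+ t) N.:* c) N.:* g N.:* N.con 1 N.:* f0 N.:* I))
    refl i t J a0 b c f0 g I

partial-first : ∀ i t → orthoTerm i 0 (suc t) ≡ orthoPartial i 0 t
partial-first i t = cong (sign 0 *_) (frac-cross _ _ _ _ (orthoDen≢0 i 0 (suc t)) (partialDen≢0 i 0 t) eq)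
  where
  eJ : (i ℕ.+ 0) ℕ.+ double (suc t) ≡ i ℕ.+ double (suc t)
  eJ = cong (ℕ._+ double (suc t)) (ℕP.+-identityʳ i)
  eB : suc ((i ℕ.+ 0) ℕ.+ suc t) ≡ suc (i ℕ.+ suc t ℕ.+ 0)
  eB = ((∀ i t → 1 ℕ.+ ((i ℕ.+ 0) ℕ.+ (1 ℕ.+ t)) ≡ 1 ℕ.+ (i ℕ.+ (1 ℕ.+ t) ℕ.+ 0)) ∋ solve-∀) i t
  eG : suc (suc (((i ℕ.+ 0) ℕ.+ double (suc t)) ℕ.+ (i ℕ.+ 0))) ≡ suc (suc (double (i ℕ.+ suc t ℕ.+ 0)))
  eG = ((∀ i t → 2 ℕ.+ (((i ℕ.+ 0) ℕ.+ ((1 ℕ.+ t) ℕ.+ (1 ℕ.+ t))) ℕ.+ (i ℕ.+ 0)) ≡ 2 ℕ.+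
      ((i ℕ.+ (1 ℕ.+ t) ℕ.+ 0) ℕ.+ (i ℕ.+ (1 ℕ.+ t) ℕ.+ 0))) ∋ solve-∀) i t
  eq = partial-first-nat i t ((i ℕ.+ double (suc t)) !) ((double (i ℕ.+ 0)) !) ((suc (i ℕ.+ suc t ℕ.+ 0)) !) (t !)
      ((i ℕ.+ 0) !) ((suc (suc (double (i ℕ.+ suc t ℕ.+ 0)))) !) (i !)
         _ _ _ (cong _! eJ) (cong _! eB) (cong _! eG)

partial-step-poly : ∀ i s t →
  let X = double (i ℕ.+ s); Bx = i ℕ.+ (s ℕ.+ suc (suc t)) ℕ.+ s; Gx = double Bx in
  2 ℕ.* suc (suc s ℕ.+ t) ℕ.* suc s ℕ.* suc (i ℕ.+ s) ℕ.* (4 ℕ.+ Gx) ℕ.* (3 ℕ.+ Gx)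
  ℕ.+ 2 ℕ.* (3 ℕ.+ X) ℕ.* (2 ℕ.+ X) ℕ.* (2 ℕ.+ Bx) ℕ.* suc (s ℕ.+ suc t) ℕ.* suc t
  ≡ 2 ℕ.* (1 ℕ.+ double (i ℕ.+ double (suc s))) ℕ.* (2 ℕ.+ Bx) ℕ.* (2 ℕ.+ X) ℕ.* suc (s ℕ.+ suc t) ℕ.* suc (suc s ℕ.+ t)
partial-step-poly = N.solve 3 (λ i s t →
  let X = (i N.:+ s) N.:+ (i N.:+ s)
      Bx = i N.:+ (s N.:+ (N.con 2 N.:+ t)) N.:+ s
      Gx = Bx N.:+ Bx
      s1 = N.con 1 N.:+ s
      t1 = N.con 1 N.:+ t
  in N.con 2 N.:* (N.con 1 N.:+ (s1 N.:+ t)) N.:* s1 N.:* (N.con 1 N.:+ (i N.:+ s)) N.:* (N.con 4 N.:+ Gx) N.:*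
      (N.con 3 N.:+ Gx)
     N.:+ N.con 2 N.:* (N.con 3 N.:+ X) N.:* (N.con 2 N.:+ X) N.:* (N.con 2 N.:+ Bx) N.:*
         (N.con 1 N.:+ (s N.:+ t1)) N.:* t1
     N.:= N.con 2 N.:* (N.con 1 N.:+ ((i N.:+ (s1 N.:+ s1)) N.:+ (i N.:+ (s1 N.:+ s1)))) N.:* (N.con 2 N.:+ Bx)
         N.:* (N.con 2 N.:+ X) N.:* (N.con 1 N.:+ (s N.:+ t1)) N.:* (N.con 1 N.:+ (s1 N.:+ t)))
  refl

partial-step-factor : ∀ J a b c e f g I s1 t1 r1 r2 qA3 qA2 qB qF qG4 qG3 qT →
  2 ℕ.* r2 ℕ.* s1 ℕ.* qF ℕ.* qG4 ℕ.* qG3 ℕ.+ 2 ℕ.* qA3 ℕ.* qA2 ℕ.* qB ℕ.* r1 ℕ.* t1 ≡ qT ℕ.* qB ℕ.* qA2 ℕ.* r1 ℕ.* r2 →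
  ((2 ℕ.* J ℕ.* a ℕ.* b) ℕ.* (r2 ℕ.* c ℕ.* (s1 ℕ.* e) ℕ.* (qF ℕ.* f) ℕ.* (qG4 ℕ.* (qG3 ℕ.* g)) ℕ.* I)
    ℕ.+ (2 ℕ.* J ℕ.* (qA3 ℕ.* (qA2 ℕ.* a)) ℕ.* (qB ℕ.* b)) ℕ.* (r1 ℕ.* (t1 ℕ.* c) ℕ.* e ℕ.* f ℕ.* g ℕ.* I))
  ℕ.* ((t1 ℕ.* c) ℕ.* (qG4 ℕ.* (qG3 ℕ.* g)) ℕ.* (s1 ℕ.* e) ℕ.* (qF ℕ.* f) ℕ.* I)
  ≡ (qT ℕ.* J ℕ.* (qB ℕ.* b) ℕ.* (qA2 ℕ.* a))
    ℕ.* ((r1 ℕ.* (t1 ℕ.* c) ℕ.* e ℕ.* f ℕ.* g ℕ.* I) ℕ.*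
        (r2 ℕ.* c ℕ.* (s1 ℕ.* e) ℕ.* (qF ℕ.* f) ℕ.* (qG4 ℕ.* (qG3 ℕ.* g)) ℕ.* I))
partial-step-factor J a b c e f g I s1 t1 r1 r2 qA3 qA2 qB qF qG4 qG3 qT eq = begin
  _ ≡⟨ N.solve 19 (λ J a b c e f g I s1 t1 r1 r2 qA3 qA2 qB qF qG4 qG3 qT →
        ((N.con 2 N.:* J N.:* a N.:* b) N.:*
            (r2 N.:* c N.:* (s1 N.:* e) N.:* (qF N.:* f) N.:* (qG4 N.:* (qG3 N.:* g)) N.:* I)
          N.:+ (N.con 2 N.:* J N.:* (qA3 N.:* (qA2 N.:* a)) N.:* (qB N.:* b)) N.:*
              (r1 N.:* (t1 N.:* c) N.:* e N.:* f N.:* g N.:* I))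
        N.:* ((t1 N.:* c) N.:* (qG4 N.:* (qG3 N.:* g)) N.:* (s1 N.:* e) N.:* (qF N.:* f) N.:* I)
        N.:= (J N.:* a N.:* b N.:* c N.:* e N.:* f N.:* g N.:* I N.:* c N.:* e N.:* f N.:* g N.:* I N.:* t1 N.:*
            qG4 N.:* qG3 N.:* s1 N.:* qF)
             N.:* (N.con 2 N.:* r2 N.:* s1 N.:* qF N.:* qG4 N.:* qG3 N.:+ N.con 2 N.:* qA3 N.:* qA2 N.:* qB N.:*
                 r1 N.:* t1))
        refl J a b c e f g I s1 t1 r1 r2 qA3 qA2 qB qF qG4 qG3 qT ⟩
  K ℕ.* (2 ℕ.* r2 ℕ.* s1 ℕ.* qF ℕ.* qG4 ℕ.* qG3 ℕ.+ 2 ℕ.* qA3 ℕ.* qA2 ℕ.* qB ℕ.* r1 ℕ.* t1)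
    ≡⟨ cong (K ℕ.*_) eq ⟩
  K ℕ.* (qT ℕ.* qB ℕ.* qA2 ℕ.* r1 ℕ.* r2)
    ≡⟨ N.solve 19 (λ J a b c e f g I s1 t1 r1 r2 qA3 qA2 qB qF qG4 qG3 qT →
        (J N.:* a N.:* b N.:* c N.:* e N.:* f N.:* g N.:* I N.:* c N.:* e N.:* f N.:* g N.:* I N.:* t1 N.:* qG4
            N.:* qG3 N.:* s1 N.:* qF) N.:* (qT N.:* qB N.:* qA2 N.:* r1 N.:* r2)
        N.:= (qT N.:* J N.:* (qB N.:* b) N.:* (qA2 N.:* a))
          N.:* ((r1 N.:* (t1 N.:* c) N.:* e N.:* f N.:* g N.:* I) N.:*
              (r2 N.:* c N.:* (s1 N.:* e) N.:* (qF N.:* f) N.:* (qG4 N.:* (qG3 N.:* g)) N.:* I)))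
        refl J a b c e f g I s1 t1 r1 r2 qA3 qA2 qB qF qG4 qG3 qT ⟩
  _ ∎
  where
  open ≡-Reasoning
  K = J ℕ.* a ℕ.* b ℕ.* c ℕ.* e ℕ.* f ℕ.* g ℕ.* I ℕ.* c ℕ.* e ℕ.* f ℕ.* g ℕ.* I ℕ.* t1 ℕ.* qG4 ℕ.* qG3 ℕ.* s1 ℕ.* qF

-- Cross-multiplied form of partial-step; the hypotheses express each shifted factorial
-- through the recurrence m! = m · (m-1)!.
partial-step-nat : ∀ i s t J a b c e f g I J2 A2 B2 F2 G2 JT BT AT GT FT →
  J2 ≡ J → A2 ≡ (3 ℕ.+ double (i ℕ.+ s)) ℕ.* ((2 ℕ.+ double (i ℕ.+ s)) ℕ.* a) →
  B2 ≡ (2 ℕ.+ (i ℕ.+ (s ℕ.+ suc (suc t)) ℕ.+ s)) ℕ.* b → F2 ≡ suc (i ℕ.+ s) ℕ.* f →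
  G2 ≡ (4 ℕ.+ double (i ℕ.+ (s ℕ.+ suc (suc t)) ℕ.+ s)) ℕ.* ((3 ℕ.+ double (i ℕ.+ (s ℕ.+ suc (suc t)) ℕ.+ s)) ℕ.* g) →
  JT ≡ J → BT ≡ (2 ℕ.+ (i ℕ.+ (s ℕ.+ suc (suc t)) ℕ.+ s)) ℕ.* b → AT ≡ (2 ℕ.+ double (i ℕ.+ s)) ℕ.* a →
  GT ≡ (4 ℕ.+ double (i ℕ.+ (s ℕ.+ suc (suc t)) ℕ.+ s)) ℕ.* ((3 ℕ.+ double (i ℕ.+ (s ℕ.+ suc (suc t)) ℕ.+ s)) ℕ.* g) →
  FT ≡ suc (i ℕ.+ s) ℕ.* f →
  ((2 ℕ.* J ℕ.* a ℕ.* b) ℕ.* (suc (suc s ℕ.+ t) ℕ.* c ℕ.* (suc s ℕ.* e) ℕ.* F2 ℕ.* G2 ℕ.* I)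
    ℕ.+ (2 ℕ.* J2 ℕ.* A2 ℕ.* B2) ℕ.* (suc (s ℕ.+ suc t) ℕ.* (suc t ℕ.* c) ℕ.* e ℕ.* f ℕ.* g ℕ.* I))
  ℕ.* ((suc t ℕ.* c) ℕ.* GT ℕ.* (suc s ℕ.* e) ℕ.* FT ℕ.* I)
  ≡ (2 ℕ.* (1 ℕ.+ double (i ℕ.+ double (suc s))) ℕ.* JT ℕ.* BT ℕ.* AT)
    ℕ.* ((suc (s ℕ.+ suc t) ℕ.* (suc t ℕ.* c) ℕ.* e ℕ.* f ℕ.* g ℕ.* I) ℕ.*
        (suc (suc s ℕ.+ t) ℕ.* c ℕ.* (suc s ℕ.* e) ℕ.* F2 ℕ.* G2 ℕ.* I))
partial-step-nat i s t J a b c e f g I _ _ _ _ _ _ _ _ _ _ refl refl refl refl refl refl refl refl refl refl =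
  partial-step-factor J a b c e f g I (suc s) (suc t) (suc (s ℕ.+ suc t)) (suc (suc s ℕ.+ t))
      (3 ℕ.+ double (i ℕ.+ s)) (2 ℕ.+ double (i ℕ.+ s))
    (2 ℕ.+ (i ℕ.+ (s ℕ.+ suc (suc t)) ℕ.+ s)) (suc (i ℕ.+ s)) (4 ℕ.+ double (i ℕ.+ (s ℕ.+ suc (suc t)) ℕ.+ s))
        (3 ℕ.+ double (i ℕ.+ (s ℕ.+ suc (suc t)) ℕ.+ s))
    (2 ℕ.* (1 ℕ.+ double (i ℕ.+ double (suc s)))) (partial-step-poly i s t)

sign-step : ∀ σ x0 x1 t → t ≡ x0 + x1 → σ * x0 + (- 1ℚ * σ) * t ≡ (- 1ℚ * σ) * x1
sign-step σ x0 x1 t refl = solve 3 (λ σ a b → σ :* a :+ (:- con 1ℚ :* σ) :* (a :+ b) := (:- con 1ℚ :* σ) :* b)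
    refl σ x0 x1

partial-step : ∀ i s t → orthoPartial i s (suc t) + orthoTerm i (suc s) (suc t) ≡ orthoPartial i (suc s) t
partial-step i s t = sign-step (sign s) _ _ _
    (sym (trans (frac-add _ _ _ _ (partialDen≢0 i s (suc t)) (partialDen≢0 i (suc s) t))
   (frac-cross _ _ _ _ ((partialDen≢0 i s (suc t)) *≢0 (partialDen≢0 i (suc s) t)) (orthoDen≢0 i (suc s) (suc t)) eq)))
  where
  Bx = i ℕ.+ (s ℕ.+ suc (suc t)) ℕ.+ s
  eJ2 : i ℕ.+ double (suc s ℕ.+ suc t) ≡ i ℕ.+ double (s ℕ.+ suc (suc t))
  eJ2 = ((∀ i s t → i ℕ.+ ((1 ℕ.+ s ℕ.+ (1 ℕ.+ t)) ℕ.+ (1 ℕ.+ s ℕ.+ (1 ℕ.+ t))) ≡ i ℕ.+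
      ((s ℕ.+ (2 ℕ.+ t)) ℕ.+ (s ℕ.+ (2 ℕ.+ t)))) ∋ solve-∀) i s t
  eA2 : suc (double (i ℕ.+ suc s)) ≡ 3 ℕ.+ double (i ℕ.+ s)
  eA2 = ((∀ i s → 1 ℕ.+ ((i ℕ.+ (1 ℕ.+ s)) ℕ.+ (i ℕ.+ (1 ℕ.+ s))) ≡ 3 ℕ.+ ((i ℕ.+ s) ℕ.+ (i ℕ.+ s))) ∋ solve-∀) i s
  eB2 : suc (i ℕ.+ (suc s ℕ.+ suc t) ℕ.+ suc s) ≡ 2 ℕ.+ Bx
  eB2 = ((∀ i s t → 1 ℕ.+ (i ℕ.+ ((1 ℕ.+ s) ℕ.+ (1 ℕ.+ t)) ℕ.+ (1 ℕ.+ s)) ≡ 2 ℕ.+ (i ℕ.+ (s ℕ.+ (2 ℕ.+ t)) ℕ.+ s))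
      ∋ solve-∀) i s t
  eF : i ℕ.+ suc s ≡ suc (i ℕ.+ s)
  eF = ℕP.+-suc i s
  eG2 : suc (suc (double (i ℕ.+ (suc s ℕ.+ suc t) ℕ.+ suc s))) ≡ 4 ℕ.+ double Bx
  eG2 = N.solve 3 (λ i s t → let u = i N.:+ ((N.con 1 N.:+ s) N.:+ (N.con 1 N.:+ t)) N.:+ (N.con 1 N.:+ s)
                                 v = i N.:+ (s N.:+ (N.con 2 N.:+ t)) N.:+ s
                             in N.con 2 N.:+ (u N.:+ u) N.:= N.con 4 N.:+ (v N.:+ v)) refl i s t
  eJT : (i ℕ.+ double (suc s)) ℕ.+ double (suc t) ≡ i ℕ.+ double (s ℕ.+ suc (suc t))
  eJT = ((∀ i s t → (i ℕ.+ ((1 ℕ.+ s) ℕ.+ (1 ℕ.+ s))) ℕ.+ ((1 ℕ.+ t) ℕ.+ (1 ℕ.+ t)) ≡ i ℕ.+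
      ((s ℕ.+ (2 ℕ.+ t)) ℕ.+ (s ℕ.+ (2 ℕ.+ t)))) ∋ solve-∀) i s t
  eBT : suc ((i ℕ.+ double (suc s)) ℕ.+ suc t) ≡ 2 ℕ.+ Bx
  eBT = ((∀ i s t → 1 ℕ.+ ((i ℕ.+ ((1 ℕ.+ s) ℕ.+ (1 ℕ.+ s))) ℕ.+ (1 ℕ.+ t)) ≡ 2 ℕ.+
      (i ℕ.+ (s ℕ.+ (2 ℕ.+ t)) ℕ.+ s)) ∋ solve-∀) i s t
  eAT : double (i ℕ.+ suc s) ≡ 2 ℕ.+ double (i ℕ.+ s)
  eAT = ((∀ i s → (i ℕ.+ (1 ℕ.+ s)) ℕ.+ (i ℕ.+ (1 ℕ.+ s)) ≡ 2 ℕ.+ ((i ℕ.+ s) ℕ.+ (i ℕ.+ s))) ∋ solve-∀) i s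
  eGT : suc (suc (((i ℕ.+ double (suc s)) ℕ.+ double (suc t)) ℕ.+ (i ℕ.+ double (suc s)))) ≡ 4 ℕ.+ double Bx
  eGT = N.solve 3 (λ i s t → let k = i N.:+ ((N.con 1 N.:+ s) N.:+ (N.con 1 N.:+ s))
                                 v = i N.:+ (s N.:+ (N.con 2 N.:+ t)) N.:+ s
                             in N.con 2 N.:+ ((k N.:+ ((N.con 1 N.:+ t) N.:+ (N.con 1 N.:+ t))) N.:+ k) N.:= N.con
                                 4 N.:+ (v N.:+ v)) refl i s t
  eq = partial-step-nat i s t ((i ℕ.+ double (s ℕ.+ suc (suc t))) !) ((suc (double (i ℕ.+ s))) !) ((suc Bx) !)
      (t !) (s !) ((i ℕ.+ s) !) ((suc (suc (double Bx))) !) (i !)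
         _ _ _ _ _ _ _ _ _ _
         (cong _! eJ2) (cong _! eA2) (cong _! eB2) (cong _! eF) (cong _! eG2)
         (cong _! eJT) (cong _! eBT) (cong _! eAT) (cong _! eGT) (cong _! eF)

partial-last-poly : ∀ i s →
  2 ℕ.* (4 ℕ.+ double (i ℕ.+ (s ℕ.+ 1) ℕ.+ s)) ℕ.* (3 ℕ.+ double (i ℕ.+ (s ℕ.+ 1) ℕ.+ s)) ℕ.* suc s ℕ.* suc (i ℕ.+ s)
  ≡ 2 ℕ.* (1 ℕ.+ double (i ℕ.+ double (suc s))) ℕ.* (2 ℕ.+ (i ℕ.+ (s ℕ.+ 1) ℕ.+ s)) ℕ.* (2 ℕ.+ double (i ℕ.+ s))
      ℕ.* suc (s ℕ.+ 0)
partial-last-poly = N.solve 2 (λ i s →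
  let X = (i N.:+ s) N.:+ (i N.:+ s)
      Bx = i N.:+ (s N.:+ N.con 1) N.:+ s
      Gx = Bx N.:+ Bx
      s1 = N.con 1 N.:+ s
  in N.con 2 N.:* (N.con 4 N.:+ Gx) N.:* (N.con 3 N.:+ Gx) N.:* s1 N.:* (N.con 1 N.:+ (i N.:+ s))
     N.:= N.con 2 N.:* (N.con 1 N.:+ ((i N.:+ (s1 N.:+ s1)) N.:+ (i N.:+ (s1 N.:+ s1)))) N.:* (N.con 2 N.:+ Bx)
         N.:* (N.con 2 N.:+ X) N.:* (N.con 1 N.:+ (s N.:+ N.con 0)))
  refl

partial-last-factor : ∀ J a b e f g I s1 r qA2 qB qF qG4 qG3 qT →
  2 ℕ.* qG4 ℕ.* qG3 ℕ.* s1 ℕ.* qF ≡ qT ℕ.* qB ℕ.* qA2 ℕ.* r →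
  (2 ℕ.* J ℕ.* a ℕ.* b) ℕ.* (1 ℕ.* (qG4 ℕ.* (qG3 ℕ.* g)) ℕ.* (s1 ℕ.* e) ℕ.* (qF ℕ.* f) ℕ.* I)
  ≡ (qT ℕ.* J ℕ.* (qB ℕ.* b) ℕ.* (qA2 ℕ.* a)) ℕ.* (r ℕ.* 1 ℕ.* e ℕ.* f ℕ.* g ℕ.* I)
partial-last-factor J a b e f g I s1 r qA2 qB qF qG4 qG3 qT eq = begin
  _ ≡⟨ N.solve 14 (λ J a b e f g I s1 r qA2 qB qF qG4 qG3 →
         (N.con 2 N.:* J N.:* a N.:* b) N.:*
             (N.con 1 N.:* (qG4 N.:* (qG3 N.:* g)) N.:* (s1 N.:* e) N.:* (qF N.:* f) N.:* I)
         N.:= (J N.:* a N.:* b N.:* e N.:* f N.:* g N.:* I) N.:* (N.con 2 N.:* qG4 N.:* qG3 N.:* s1 N.:* qF))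
       refl J a b e f g I s1 r qA2 qB qF qG4 qG3 ⟩
  K ℕ.* (2 ℕ.* qG4 ℕ.* qG3 ℕ.* s1 ℕ.* qF) ≡⟨ cong (K ℕ.*_) eq ⟩
  K ℕ.* (qT ℕ.* qB ℕ.* qA2 ℕ.* r) ≡⟨ N.solve 14 (λ J a b e f g I r qA2 qB qT s1 qF qG4 →
         (J N.:* a N.:* b N.:* e N.:* f N.:* g N.:* I) N.:* (qT N.:* qB N.:* qA2 N.:* r)
         N.:= (qT N.:* J N.:* (qB N.:* b) N.:* (qA2 N.:* a)) N.:* (r N.:* N.con 1 N.:* e N.:* f N.:* g N.:* I))
       refl J a b e f g I r qA2 qB qT s1 qF qG4 ⟩
  _ ∎
  where
  open ≡-Reasoning
  K = J ℕ.* a ℕ.* b ℕ.* e ℕ.* f ℕ.* g ℕ.* I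

partial-last-nat : ∀ i s J a b e f g I JT BT AT GT FT →
  JT ≡ J → BT ≡ (2 ℕ.+ (i ℕ.+ (s ℕ.+ 1) ℕ.+ s)) ℕ.* b → AT ≡ (2 ℕ.+ double (i ℕ.+ s)) ℕ.* a →
  GT ≡ (4 ℕ.+ double (i ℕ.+ (s ℕ.+ 1) ℕ.+ s)) ℕ.* ((3 ℕ.+ double (i ℕ.+ (s ℕ.+ 1) ℕ.+ s)) ℕ.* g) → FT ≡ suc
      (i ℕ.+ s) ℕ.* f →
  (2 ℕ.* J ℕ.* a ℕ.* b) ℕ.* (1 ℕ.* GT ℕ.* (suc s ℕ.* e) ℕ.* FT ℕ.* I)
  ≡ (2 ℕ.* (1 ℕ.+ double (i ℕ.+ double (suc s))) ℕ.* JT ℕ.* BT ℕ.* AT) ℕ.* (suc (s ℕ.+ 0) ℕ.* 1 ℕ.* e ℕ.* f ℕ.* g ℕ.* I)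
partial-last-nat i s J a b e f g I _ _ _ _ _ refl refl refl refl refl =
  partial-last-factor J a b e f g I (suc s) (suc (s ℕ.+ 0)) (2 ℕ.+ double (i ℕ.+ s))
      (2 ℕ.+ (i ℕ.+ (s ℕ.+ 1) ℕ.+ s)) (suc (i ℕ.+ s))
    (4 ℕ.+ double (i ℕ.+ (s ℕ.+ 1) ℕ.+ s)) (3 ℕ.+ double (i ℕ.+ (s ℕ.+ 1) ℕ.+ s))
        (2 ℕ.* (1 ℕ.+ double (i ℕ.+ double (suc s)))) (partial-last-poly i s)

sign-cancel : ∀ σ x t → x ≡ t → σ * x + (- 1ℚ * σ) * t ≡ 0ℚ
sign-cancel σ x t refl = solve 2 (λ σ a → σ :* a :+ (:- con 1ℚ :* σ) :* a := con 0ℚ) refl σ x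

partial-last : ∀ i s → orthoPartial i s 0 + orthoTerm i (suc s) 0 ≡ 0ℚ
partial-last i s = sign-cancel (sign s) _ _ (frac-cross _ _ _ _ (partialDen≢0 i s 0) (orthoDen≢0 i (suc s) 0) eq)
  where
  Bx = i ℕ.+ (s ℕ.+ 1) ℕ.+ s
  eJ : (i ℕ.+ double (suc s)) ℕ.+ 0 ≡ i ℕ.+ double (s ℕ.+ 1)
  eJ = ((∀ i s → (i ℕ.+ ((1 ℕ.+ s) ℕ.+ (1 ℕ.+ s))) ℕ.+ 0 ≡ i ℕ.+ ((s ℕ.+ 1) ℕ.+ (s ℕ.+ 1))) ∋ solve-∀) i s
  eB : suc ((i ℕ.+ double (suc s)) ℕ.+ 0) ≡ 2 ℕ.+ Bx
  eB = ((∀ i s → 1 ℕ.+ ((i ℕ.+ ((1 ℕ.+ s) ℕ.+ (1 ℕ.+ s))) ℕ.+ 0) ≡ 2 ℕ.+ (i ℕ.+ (s ℕ.+ 1) ℕ.+ s)) ∋ solve-∀) i s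
  eA : double (i ℕ.+ suc s) ≡ 2 ℕ.+ double (i ℕ.+ s)
  eA = ((∀ i s → (i ℕ.+ (1 ℕ.+ s)) ℕ.+ (i ℕ.+ (1 ℕ.+ s)) ≡ 2 ℕ.+ ((i ℕ.+ s) ℕ.+ (i ℕ.+ s))) ∋ solve-∀) i s
  eG : suc (suc (((i ℕ.+ double (suc s)) ℕ.+ 0) ℕ.+ (i ℕ.+ double (suc s)))) ≡ 4 ℕ.+ double Bx
  eG = ((∀ i s → 2 ℕ.+ (((i ℕ.+ ((1 ℕ.+ s) ℕ.+ (1 ℕ.+ s))) ℕ.+ 0) ℕ.+ (i ℕ.+ ((1 ℕ.+ s) ℕ.+ (1 ℕ.+ s)))) ≡ 4 ℕ.+
      ((i ℕ.+ (s ℕ.+ 1) ℕ.+ s) ℕ.+ (i ℕ.+ (s ℕ.+ 1) ℕ.+ s))) ∋ solve-∀) i s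
  eq = partial-last-nat i s ((i ℕ.+ double (s ℕ.+ 1)) !) ((suc (double (i ℕ.+ s))) !) ((suc Bx) !) (s !)
      ((i ℕ.+ s) !) ((suc (suc (double Bx))) !) (i !)
         _ _ _ _ _ (cong _! eJ) (cong _! eB) (cong _! eA) (cong _! eG) (cong _! (ℕP.+-suc i s))

orthoTerm-origin-nat : ∀ i f0 a0 K1 K2 K3 K4 → K1 ≡ f0 → K2 ≡ suc (i ℕ.+ 0) ℕ.* f0 →
  K3 ≡ (2 ℕ.+ double (i ℕ.+ 0)) ℕ.* ((1 ℕ.+ double (i ℕ.+ 0)) ℕ.* a0) → K4 ≡ f0 →
  (2 ℕ.* (1 ℕ.+ double (i ℕ.+ 0)) ℕ.* K1 ℕ.* K2 ℕ.* a0) ℕ.* 1 ≡ 1 ℕ.* (1 ℕ.* K3 ℕ.* 1 ℕ.* f0 ℕ.* K4)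
orthoTerm-origin-nat i f0 a0 _ _ _ _ refl refl refl refl =
  N.solve 3 (λ i f0 a0 → let X = (i N.:+ N.con 0) N.:+ (i N.:+ N.con 0) in
    (N.con 2 N.:* (N.con 1 N.:+ X) N.:* f0 N.:* ((N.con 1 N.:+ (i N.:+ N.con 0)) N.:* f0) N.:* a0) N.:* N.con 1
    N.:= N.con 1 N.:* (N.con 1 N.:* ((N.con 2 N.:+ X) N.:* ((N.con 1 N.:+ X) N.:* a0)) N.:* N.con 1 N.:* f0 N.:*
        f0)) refl i f0 a0

orthoTerm-origin : ∀ i → orthoTerm i 0 0 ≡ 1ℚ
orthoTerm-origin i = trans (*-identityˡ _) (frac-cross _ _ 1 1 (orthoDen≢0 i 0 0) (suc≢0 0) eq)
  where
  e1 : (i ℕ.+ 0) ℕ.+ 0 ≡ i ℕ.+ 0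
  e1 = ℕP.+-identityʳ (i ℕ.+ 0)
  e3 : suc (suc (((i ℕ.+ 0) ℕ.+ 0) ℕ.+ (i ℕ.+ 0))) ≡ 2 ℕ.+ double (i ℕ.+ 0)
  e3 = cong (λ x → suc (suc (x ℕ.+ (i ℕ.+ 0)))) e1
  eq = orthoTerm-origin-nat i ((i ℕ.+ 0) !) ((double (i ℕ.+ 0)) !) _ _ _ _ (cong _! e1) (cong _! (cong suc e1))
      (cong _! e3) (cong _! (sym (ℕP.+-identityʳ i)))

partial-sum : ∀ i s t → sumTo s (λ u → orthoTerm i u (s ℕ.+ suc t ∸ u)) ≡ orthoPartial i s t
partial-sum i zero t = partial-first i t
partial-sum i (suc s) t = begin
  sumTo s (λ u → orthoTerm i u (suc s ℕ.+ suc t ∸ u)) + orthoTerm i (suc s) (s ℕ.+ suc t ∸ s)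
    ≡⟨ cong₂ _+_ (cong (λ x → sumTo s (λ u → orthoTerm i u (x ∸ u))) (sym (ℕP.+-suc s (suc t))))
        (cong (orthoTerm i (suc s)) (ℕP.m+n∸m≡n s (suc t))) ⟩
  sumTo s (λ u → orthoTerm i u (s ℕ.+ suc (suc t) ∸ u)) + orthoTerm i (suc s) (suc t)
    ≡⟨ cong (_+ orthoTerm i (suc s) (suc t)) (partial-sum i s (suc t)) ⟩
  orthoPartial i s (suc t) + orthoTerm i (suc s) (suc t) ≡⟨ partial-step i s t ⟩
  orthoPartial i (suc s) t ∎
  where open ≡-Reasoning

antidiagonal-sum : ∀ i r → sumTo r (λ u → orthoTerm i u (r ∸ u)) ≡ δ i (i ℕ.+ double r)
antidiagonal-sum i zero = trans (orthoTerm-origin i) (sym (trans (cong (δ i) (ℕP.+-identityʳ i)) (δ-refl i)))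
antidiagonal-sum i (suc R) = begin
  sumTo R (λ u → orthoTerm i u (suc R ∸ u)) + orthoTerm i (suc R) (R ∸ R)
    ≡⟨ cong₂ _+_ (cong (λ x → sumTo R (λ u → orthoTerm i u (x ∸ u)))
        (trans (cong suc (sym (ℕP.+-identityʳ R))) (sym (ℕP.+-suc R 0)))) (cong (orthoTerm i (suc R)) (ℕP.n∸n≡0 R)) ⟩
  sumTo R (λ u → orthoTerm i u (R ℕ.+ suc 0 ∸ u)) + orthoTerm i (suc R) 0
    ≡⟨ cong (_+ orthoTerm i (suc R) 0) (partial-sum i R 0) ⟩
  orthoPartial i R 0 + orthoTerm i (suc R) 0 ≡⟨ partial-last i R ⟩
  0ℚ
    ≡⟨ sym (δ-ne i _ (λ e → ℕP.m≢1+m+n i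
        (trans e (trans (cong (i ℕ.+_) (cong suc (ℕP.+-suc R R))) (ℕP.+-suc i (suc (double R))))))) ⟩
  δ i (i ℕ.+ double (suc R)) ∎
  where open ≡-Reasoning

transition-zeroₘ : ∀ j i k → monoFactor j k ≡ 0ℚ → transition j i k ≡ 0ℚ
transition-zeroₘ j i k e = trans (cong (λ x → weight k * x * legendreMono k i) e)
    (solve 2 (λ a b → a :* con 0ℚ :* b := con 0ℚ) refl (weight k) (legendreMono k i))

transition-zeroₗ : ∀ j i k → legendreMono k i ≡ 0ℚ → transition j i k ≡ 0ℚ
transition-zeroₗ j i k e = trans (cong (weight k * monoFactor j k *_) e) (*-zeroʳ (weight k * monoFactor j k))

odd-sum : ∀ i s → i ℕ.+ (i ℕ.+ suc (double s)) ≡ suc (double (i ℕ.+ s))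
odd-sum i s = ((∀ i s → i ℕ.+ (i ℕ.+ (1 ℕ.+ (s ℕ.+ s))) ≡ 1 ℕ.+ ((i ℕ.+ s) ℕ.+ (i ℕ.+ s))) ∋ solve-∀) i s

OffSupport : ℕ → ℕ → ℕ → Set
OffSupport j i k = ∀ m → j ≡ k ℕ.+ double m → ∀ p → i ℕ.+ k ≡ double p → i ≤ k → ⊥

transition-vanishes : ∀ j i k → OffSupport j i k → transition j i k ≡ 0ℚ
transition-vanishes j i k off = go (monoFactor-view j k) (legendreMono-view k i)
  where
  go : Σ ℕ (λ m → j ≡ k ℕ.+ double m) ⊎ monoFactor j k ≡ 0ℚ →
       (Σ ℕ (λ p → i ℕ.+ k ≡ double p) × i ≤ k) ⊎ legendreMono k i ≡ 0ℚ →
       transition j i k ≡ 0ℚ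
  go (inj₂ e) _ = transition-zeroₘ j i k e
  go (inj₁ _) (inj₂ e) = transition-zeroₗ j i k e
  go (inj₁ (m , ej)) (inj₁ ((p , ep) , le)) = ⊥-elim (off m ej p ep le)

-- j = i + 2r: only k = i + 2s with s ≤ r contribute, giving the antidiagonal sum.
orthogonality-even : ∀ n i r → i ℕ.+ double r ≤ n → sumTo n (transition (i ℕ.+ double r) i) ≡ δ i (i ℕ.+ double r)
orthogonality-even n i r le = begin
  sumTo n (transition j i) ≡⟨ cong (λ x → sumTo x (transition j i)) (sym (ℕP.m+[n∸m]≡n le)) ⟩
  sumTo (j ℕ.+ (n ∸ j)) (transition j i) ≡⟨ sumTo-tail j (n ∸ j) (transition j i) big ⟩
  sumTo (i ℕ.+ double r) (transition j i)
    ≡⟨ sumTo-offset i (double r) (transition j i) (λ k k<i → transition-zeroₗ j i k (legendreMono-big k i k<i)) ⟩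
  sumTo (double r) (λ e → transition j i (i ℕ.+ e)) ≡⟨ sumTo-even r (λ e → transition j i (i ℕ.+ e)) odd ⟩
  sumTo r (λ s → transition j i (i ℕ.+ double s))
    ≡⟨ sumTo-cong r (λ s s≤r → trans (cong (λ x → transition x i (i ℕ.+ double s)) (ej s s≤r))
        (transition-explicit i s (r ∸ s))) ⟩
  sumTo r (λ u → orthoTerm i u (r ∸ u)) ≡⟨ antidiagonal-sum i r ⟩
  δ i j ∎
  where
  open ≡-Reasoning
  j = i ℕ.+ double r
  big : ∀ k → j < k → transition j i k ≡ 0ℚ
  big k j<k = transition-vanishes j i k
      (λ m e _ _ _ → ℕP.<-irrefl refl (ℕP.<-≤-trans j<k (subst (k ≤_) (sym e) (ℕP.m≤m+n k (double m)))))
  odd : ∀ s → transition j i (i ℕ.+ suc (double s)) ≡ 0ℚ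
  odd s = transition-vanishes j i (i ℕ.+ suc (double s))
      (λ _ _ p e _ → double≢odd p (i ℕ.+ s) (trans (sym e) (odd-sum i s)))
  ej : ∀ s → s ≤ r → j ≡ (i ℕ.+ double s) ℕ.+ double (r ∸ s)
  ej s s≤r = trans (cong (λ x → i ℕ.+ double x) (sym (ℕP.m+[n∸m]≡n s≤r)))
    (((∀ i s d → i ℕ.+ ((s ℕ.+ d) ℕ.+ (s ℕ.+ d)) ≡ (i ℕ.+ (s ℕ.+ s)) ℕ.+ (d ℕ.+ d)) ∋ solve-∀) i s (r ∸ s))

orthogonality-below : ∀ n i j → ¬ (i ≤ j) → sumTo n (transition j i) ≡ δ i j
orthogonality-below n i j i≰j =
  trans (sumTo-zero n (transition j i) (λ k _ → transition-vanishes j i k (outside k)))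
        (sym (δ-ne i j (λ e → i≰j (ℕP.≤-reflexive e))))
  where
  outside : ∀ k → OffSupport j i k
  outside k m ej p _ i≤k = i≰j (ℕP.≤-trans i≤k (subst (k ≤_) (sym ej) (ℕP.m≤m+n k (double m))))

orthogonality-odd : ∀ n i j r → j ≡ i ℕ.+ suc (double r) → sumTo n (transition j i) ≡ δ i j
orthogonality-odd n i j r ej =
  trans (sumTo-zero n (transition j i) (λ k _ → transition-vanishes j i k (outside k)))
        (sym (δ-ne i j (λ e → ℕP.m≢1+m+n i (trans e (trans ej (ℕP.+-suc i (double r)))))))
  where
  outside : ∀ k → OffSupport j i k
  outside k m ek p ep _ = double≢odd (p ℕ.+ m) (i ℕ.+ r) (trans (sym even-sum) odd-sum′)
    where
    even-sum : i ℕ.+ j ≡ double (p ℕ.+ m)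
    even-sum = trans (cong (i ℕ.+_) ek) (trans (sym (ℕP.+-assoc i k (double m))) (trans (cong (ℕ._+ double m) ep)
           (((∀ p m → (p ℕ.+ p) ℕ.+ (m ℕ.+ m) ≡ (p ℕ.+ m) ℕ.+ (p ℕ.+ m)) ∋ solve-∀) p m)))
    odd-sum′ : i ℕ.+ j ≡ suc (double (i ℕ.+ r))
    odd-sum′ = trans (cong (i ℕ.+_) ej) (odd-sum i r)

orthogonality-above : ∀ n i j → j ≤ n → i ≤ j →
  Σ ℕ (λ r → j ∸ i ≡ double r) ⊎ Σ ℕ (λ r → j ∸ i ≡ suc (double r)) →
  sumTo n (transition j i) ≡ δ i j
orthogonality-above n i j j≤n i≤j (inj₁ (r , e)) =
  subst (λ x → sumTo n (transition x i) ≡ δ i x) (sym ej) (orthogonality-even n i r (subst (_≤ n) ej j≤n))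
  where
  ej : j ≡ i ℕ.+ double r
  ej = trans (sym (ℕP.m+[n∸m]≡n i≤j)) (cong (i ℕ.+_) e)
orthogonality-above n i j j≤n i≤j (inj₂ (r , e)) =
  orthogonality-odd n i j r (trans (sym (ℕP.m+[n∸m]≡n i≤j)) (cong (i ℕ.+_) e))

orthogonality : ∀ n i j → j ≤ n → sumTo n (transition j i) ≡ δ i j
orthogonality n i j j≤n with i ≤? j
... | yes i≤j = orthogonality-above n i j j≤n i≤j (parity (j ∸ i))
... | no i≰j  = orthogonality-below n i j i≰j

-- x^j = Σ_{k ≤ n} c(j,k) P_k(x) for j ≤ n: expand P_k in monomials and apply orthogonality.
monomial-expansion : ∀ n j x → j ≤ n → pow x j ≡ sumTo n (λ k → weight k * monoFactor j k * legendre k x)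
monomial-expansion n j x j≤n = sym (begin
  sumTo n (λ k → weight k * monoFactor j k * legendre k x)
    ≡⟨ sumTo-cong n (λ k k≤n → trans (cong (weight k * monoFactor j k *_) (legendre-ext n k x k≤n))
                                      (sumTo-*l n (weight k * monoFactor j k) (λ i → legendreMono k i * pow x i))) ⟩
  sumTo n (λ k → sumTo n (λ i → weight k * monoFactor j k * (legendreMono k i * pow x i)))
    ≡⟨ sumTo-cong n (λ k _ → sumTo-cong n (λ i _ → regroup (weight k) (monoFactor j k) (legendreMono k i) (pow x i))) ⟩
  sumTo n (λ k → sumTo n (λ i → pow x i * transition j i k)) ≡⟨ sumTo-swap n n _ ⟩
  sumTo n (λ i → sumTo n (λ k → pow x i * transition j i k))
    ≡⟨ sumTo-cong n (λ i _ → trans (sym (sumTo-*l n (pow x i) (transition j i)))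
                                    (cong (pow x i *_) (orthogonality n i j j≤n))) ⟩
  sumTo n (λ i → pow x i * δ i j) ≡⟨ sumTo-delta n j (pow x) j≤n ⟩
  pow x j ∎)
  where
  open ≡-Reasoning
  regroup : ∀ w c l p → w * c * (l * p) ≡ p * (w * c * l)
  regroup = solve 4 (λ w c l p → w :* c :* (l :* p) := p :* (w :* c :* l)) refl

bernoulliPoly-ascending : ∀ n x → bernoulliPoly n x ≡ sumTo n (λ j → ι (n C j) * bernoulliNumber (n ∸ j) * pow x j)
bernoulliPoly-ascending n x = trans (sumTo-reverse n _) (sumTo-cong n (λ j j≤n →
  cong₂ (λ u v → ι u * bernoulliNumber (n ∸ j) * pow x v) (sym (nCk≡nC[n∸k] j≤n)) (ℕP.m∸[m∸n]≡n j≤n)))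

legendreCoeff-split : ∀ n k →
  legendreCoeff n k ≡ sumTo n (λ j → ι (n C j) * bernoulliNumber (n ∸ j) * (weight k * monoFactor j k))
legendreCoeff-split n k = begin
  weight k * sumTo n (innerTerm n k)
    ≡⟨ cong (weight k *_) (sumTo-cong n (λ j _ → innerTerm-split n k j)) ⟩
  weight k * sumTo n (λ j → b j * monoFactor j k)      ≡⟨ sumTo-*l n (weight k) _ ⟩
  sumTo n (λ j → weight k * (b j * monoFactor j k))
    ≡⟨ sumTo-cong n (λ j _ → solve 3 (λ w c m → w :* (c :* m) := c :* (w :* m)) refl (weight k) (b j)
        (monoFactor j k)) ⟩
  sumTo n (λ j → b j * (weight k * monoFactor j k)) ∎
  where
  open ≡-Reasoning
  b : ℕ → ℚ
  b j = ι (n C j) * bernoulliNumber (n ∸ j)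

-- Replace each monomial of B_n by its Legendre expansion and collect the coefficients.
theorem1 : (n : ℕ) (x : ℚ) →
    bernoulliPoly n x ≡ sumTo n (λ k → legendreCoeff n k * legendre k x)
theorem1 n x = sym (begin
  sumTo n (λ k → legendreCoeff n k * legendre k x)
    ≡⟨ sumTo-cong n (λ k _ → trans (cong (_* legendre k x) (legendreCoeff-split n k)) (distribute k)) ⟩
  sumTo n (λ k → sumTo n (λ j → b j * (c j k * legendre k x)))   ≡⟨ sumTo-swap n n _ ⟩
  sumTo n (λ j → sumTo n (λ k → b j * (c j k * legendre k x)))
    ≡⟨ sumTo-cong n (λ j _ → sym (sumTo-*l n (b j) _)) ⟩
  sumTo n (λ j → b j * sumTo n (λ k → c j k * legendre k x))
    ≡⟨ sumTo-cong n (λ j j≤n → cong (b j *_) (sym (monomial-expansion n j x j≤n))) ⟩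
  sumTo n (λ j → b j * pow x j)                                 ≡⟨ bernoulliPoly-ascending n x ⟨
  bernoulliPoly n x ∎)
  where
  open ≡-Reasoning
  b : ℕ → ℚ
  b j = ι (n C j) * bernoulliNumber (n ∸ j)
  c : ℕ → ℕ → ℚ
  c j k = weight k * monoFactor j k
  distribute : ∀ k → sumTo n (λ j → b j * c j k) * legendre k x ≡ sumTo n (λ j → b j * (c j k * legendre k x))
  distribute k = trans (sumTo-*r n (legendre k x) _) (sumTo-cong n (λ j _ → *-assoc (b j) (c j k) (legendre k x)))
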